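{- Let $k,m,p,q\ge 0$ and $\ell\ge 1$ be integers with $k+2m=2p+q$, and let $W(k,m,\ell,p,q)$ be the two-vertex graph with $k$ semi-edges and $m$ loops at one vertex, $p$ loops and $q$ semi-edges at the other vertex, and $\ell$ parallel ordinary edges joining the two vertices. Then a bipartite graph $G$ with no semi-edges covers $W(k,m,\ell,p,q)$ if and only if $G$ admits a $(k+2m,\ell)$-coloring.
   Context: A graph is finite and may have ordinary edges (two distinct end-vertices, parallels allowed), loops (one end-vertex, contributing 2 to its degree) and semi-edges (one end-vertex, contributing 1 to its degree). A covering projection $f:G\to H$ is a pair of maps $f_V:V(G)\to V(H)$, $f_E:E(G)\to E(H)$ such that: loops/semi-edges of $G$ at $u$ map to loops/semi-edges (respectively) of $H$ at $f_V(u)$; an ordinary edge $uv$ of $G$ maps to an ordinary edge of $H$ joining $f_V(u)\ne f_V(v)$, or, when $f_V(u)=f_V(v)$, to a loop or semi-edge at $f_V(u)$; the preimage of each loop of $H$ at $w$ is a disjoint union of loops and cycles spanning $f_V^{ -1}(w)$; the preimage of each semi-edge of $H$ at $w$ is a disjoint union of ordinary edges and semi-edges spanning $f_V^{ -1}(w)$ (each vertex incident with exactly one); the preimage of each ordinary edge of $H$ joining $w,w'$ is a matching spanning $f_V^{ -1}(w)\cup f_V^{ -1}(w')$. $G$ covers $H$ if such a projection exists. For positive integers $b,c$, a $(b,c)$-coloring of a graph is a 2-coloring of its vertices such that every vertex has exactly $b$ neighbors of its own color and exactly $c$ neighbors of the other color (neighbors counted with edge multiplicity). -}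

module Defs where

open import Data.Nat using (ℕ; zero; suc; _+_; _*_; _<_)
open import Data.Fin using (Fin; _≟_)
import Data.Fin as F
open import Data.Bool using (Bool; true; false)
import Data.Bool as B
open import Data.Vec using (Vec; lookup; replicate; _++_)
open import Data.Product using (Σ; _×_; _,_)
open import Data.Sum using (_⊎_)
open import Relation.Nullary using (¬_; yes; no)
open import Relation.Binary.PropositionalEquality using (_≡_; _≢_)

data Ends (n : ℕ) : Set where
  ordinary : Fin n → Fin n → Ends n   -- ordinary edge joining two (distinct, see WellFormed) vertices
  loop     : Fin n → Ends n
  semi     : Fin n → Ends n

record Graph : Set where
  constructor mkGraph
  field
    nV   : ℕ
    nE   : ℕ
    ends : Vec (Ends nV) nE
open Graph public

edge : (G : Graph) → Fin (nE G) → Ends (nV G)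
edge G e = lookup (ends G) e

WellFormed : Graph → Set
WellFormed G = ∀ e u v → edge G e ≡ ordinary u v → u ≢ v

NoSemiEdges : Graph → Set
NoSemiEdges G = ∀ e u → edge G e ≢ semi u

Bipartite : Graph → Set
Bipartite G = (∀ e u → edge G e ≢ loop u) ×
  Σ (Fin (nV G) → Bool) λ χ → ∀ e u v → edge G e ≡ ordinary u v → χ u ≢ χ v

sumFin : (n : ℕ) → (Fin n → ℕ) → ℕ
sumFin zero    f = 0
sumFin (suc n) f = f F.zero + sumFin n (λ i → f (F.suc i))

eqInd : {n : ℕ} → Fin n → Fin n → ℕ
eqInd a b with a ≟ b
... | yes _ = 1
... | no  _ = 0

mult : {n : ℕ} → Ends n → Fin n → ℕ
mult (ordinary a b) u = eqInd a u + eqInd b u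
mult (loop a)       u = 2 * eqInd a u
mult (semi a)       u = eqInd a u

required : {n : ℕ} → Ends n → ℕ
required (ordinary _ _) = 1
required (loop _)       = 2
required (semi _)       = 1

module _ (G H : Graph) (fV : Fin (nV G) → Fin (nV H)) (fE : Fin (nE G) → Fin (nE H)) where

  EdgeOK : Ends (nV G) → Ends (nV H) → Set
  EdgeOK (loop u)       h = h ≡ loop (fV u)
  EdgeOK (semi u)       h = h ≡ semi (fV u)
  EdgeOK (ordinary u v) h =
    (fV u ≢ fV v × (h ≡ ordinary (fV u) (fV v) ⊎ h ≡ ordinary (fV v) (fV u)))
    ⊎ (fV u ≡ fV v × (h ≡ loop (fV u) ⊎ h ≡ semi (fV u)))

  preDeg : Fin (nV G) → Fin (nE H) → ℕ
  preDeg u h = sumFin (nE G) (λ e → eqInd (fE e) h * mult (edge G e) u)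

  IsCovering : Set
  IsCovering =
    (∀ e → EdgeOK (edge G e) (edge H (fE e))) ×
    -- for every edge h of H and every vertex u of G in the fibre of an end of h,
    -- u has degree 2 (h a loop: preimage is a spanning disjoint union of loops and
    -- cycles) resp. 1 (h a semi-edge or ordinary edge: each fibre vertex is incident
    -- with exactly one preimage edge) in the preimage of h.
    (∀ h u → 0 < mult (edge H h) (fV u) → preDeg u h ≡ required (edge H h))

Covers : Graph → Graph → Set
Covers G H = Σ (Fin (nV G) → Fin (nV H)) λ fV → Σ (Fin (nE G) → Fin (nE H)) λ fE →
  IsCovering G H fV fE

-- number of neighbours of u (counted with edge multiplicity, via ordinary edges)
-- whose colour equals (s = true) / differs from (s = false) the colour of u
colNbr : (G : Graph) → (Fin (nV G) → Bool) → Bool → Fin (nV G) → ℕ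
colNbr G χ s u = sumFin (nE G) (λ e → contrib (edge G e))
  where
    ind : Bool → ℕ
    ind true  = 1
    ind false = 0
    sameAs : Fin (nV G) → Bool
    sameAs v with χ u B.≟ χ v
    ... | yes _ = s
    ... | no  _ = B.not s
    contrib : Ends (nV G) → ℕ
    contrib (ordinary a b) = eqInd a u * ind (sameAs b) + eqInd b u * ind (sameAs a)
    contrib (loop _)       = 0
    contrib (semi _)       = 0

IsColoring : (b c : ℕ) (G : Graph) → (Fin (nV G) → Bool) → Set
IsColoring b c G χ = ∀ u → colNbr G χ true u ≡ b × colNbr G χ false u ≡ c

HasColoring : (b c : ℕ) → Graph → Set
HasColoring b c G = Σ (Fin (nV G) → Bool) λ χ → IsColoring b c G χ

W : (k m ℓ p q : ℕ) → Graph
W k m ℓ p q = mkGraph 2 (k + (m + (ℓ + (p + q))))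
  (replicate k (semi F.zero) ++ replicate m (loop F.zero) ++
   replicate ℓ (ordinary F.zero (F.suc F.zero)) ++
   replicate p (loop (F.suc F.zero)) ++ replicate q (semi (F.suc F.zero)))

-- A covering projection G → W sends the edges at each vertex u bijectively onto the edge-ends at
-- the image of u. Colouring u by its image, the lifts of loops and semi-edges of W join equally
-- coloured vertices and the lifts of the ℓ ordinary edges join differently coloured ones, so every
-- vertex has k + 2m = 2p + q neighbours of its own colour and ℓ of the other.
--
-- Conversely, in a (k+2m, ℓ)-coloured bipartite G the monochromatic edges of either colour and
-- the bichromatic edges form regular bipartite multigraphs. Such a d-regular multigraph splits
-- into d perfect matchings (König), and these can be handed out to the edges of W with prescribed
-- multiplicities: one matching per semi-edge, two per loop, one per ordinary edge. The resulting
-- edge map is the covering projection. König's theorem comes from Hall's theorem, proved by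
-- deleting edges: if a vertex of the saturated side has two edges, deleting one of them preserves
-- Hall's condition, since two violators of the two deletions would combine into a violator of
-- the original graph.

module Submission where

open import Defs
open import Data.Bool using (Bool; true; false; T; T?; _∧_; _∨_; not; if_then_else_)
import Data.Bool.Properties as Bool
open import Data.Bool.Properties using (T-≡; T-∧; T-∨; ∧-zeroʳ; ∧-identityʳ; ∧-comm; ¬-not)
open import Data.Empty using (⊥; ⊥-elim)
open import Data.Fin using (Fin; zero; suc; _≟_; fromℕ<)
open import Data.Fin.Properties using (any?)
open import Data.Fin.Subset.Properties using (anySubset?)
open import Data.Nat using (ℕ; zero; suc; _+_; _*_; _∸_; _≤_; _<_; _<ᵇ_; _<?_; z≤n; s≤s; z<s)
open import Data.Nat.Induction using (<-wellFounded)
open import Data.Nat.Properties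
  using (+-*-semiring; +-assoc; +-comm; +-suc; +-identityʳ; *-assoc; *-comm; *-identityˡ; *-identityʳ; *-zeroʳ;
         *-distribˡ-+; *-distribʳ-+; +-cancelˡ-≡; +-cancelʳ-≤; *-cancelˡ-≡; *-cancelˡ-≤; +-mono-≤; +-monoʳ-≤;
         ≤-reflexive; ≤-trans; ≤-antisym; <-irrefl; <⇒≱; ≮⇒≥; n≮0; n≤0⇒n≡0; m≤m+n; m≤n+m; m+[n∸m]≡n;
         suc-injective; <ᵇ⇒<; <⇒<ᵇ; module ≤-Reasoning)
open import Data.Nat.Tactic.RingSolver using (solve-∀)
open import Algebra.Properties.Semiring.Sum +-*-semiring
  using (sum; sum-syntax; sum-cong-≗; sum-replicate-zero; ∑-distrib-+; ∑-comm; *-distribˡ-sum)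
open import Data.Product using (∃; _×_; _,_; proj₁; proj₂; map₂)
open import Data.Sum using (_⊎_; inj₁; inj₂; [_,_]′)
import Data.Sum
open import Data.Vec using (Vec; []; _∷_; _++_; replicate; lookup; tabulate)
open import Data.Vec.Properties using (lookup∘tabulate)
open import Data.Vec.Relation.Unary.All using (All; []; _∷_)
import Data.Vec.Relation.Unary.All.Properties as All
open import Function using (_∘_; id)
open import Function.Bundles using (Equivalence; _⇔_; mk⇔)
open import Induction.WellFounded using (Acc; acc)
open import Relation.Binary.PropositionalEquality
open import Relation.Nullary using (Dec; does; yes; no; ¬_; ¬?; contradiction)
open import Relation.Nullary.Decidable using (dec-true; dec-false; map′; _×-dec_; decidable-stable)

𝟙 : Bool → ℕ
𝟙 true  = 1
𝟙 false = 0

𝟙-∧ : ∀ a b → 𝟙 (a ∧ b) ≡ 𝟙 a * 𝟙 b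
𝟙-∧ true  b = sym (+-identityʳ (𝟙 b))
𝟙-∧ false b = refl

eqInd≡𝟙 : ∀ {n} (a b : Fin n) → eqInd a b ≡ 𝟙 (does (a ≟ b))
eqInd≡𝟙 a b with a ≟ b
... | yes _ = refl
... | no  _ = refl

sumFin≡sum : ∀ n (f : Fin n → ℕ) → sumFin n f ≡ sum f
sumFin≡sum zero    f = refl
sumFin≡sum (suc n) f = cong (f zero +_) (sumFin≡sum n (f ∘ suc))

sum-mono-≤ : ∀ {n} {f g : Fin n → ℕ} → (∀ i → f i ≤ g i) → sum f ≤ sum g
sum-mono-≤ {zero}  f≤g = z≤n
sum-mono-≤ {suc n} f≤g = +-mono-≤ (f≤g zero) (sum-mono-≤ (f≤g ∘ suc))

term≤sum : ∀ {n} (f : Fin n → ℕ) i → f i ≤ sum f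
term≤sum f zero    = m≤m+n (f zero) _
term≤sum f (suc i) = ≤-trans (term≤sum (f ∘ suc) i) (m≤n+m _ (f zero))

sum-positive : ∀ {n} (f : Fin n → ℕ) → 0 < sum f → ∃ λ i → 0 < f i
sum-positive {suc n} f 0<∑ with f zero in f₀
... | suc _ = zero , subst (0 <_) (sym f₀) z<s
... | zero  = let i , 0<fi = sum-positive (f ∘ suc) 0<∑ in suc i , 0<fi

sum-≡⇒≗ : ∀ {n} {f g : Fin n → ℕ} → (∀ i → f i ≤ g i) → sum f ≡ sum g → f ≗ g
sum-≡⇒≗ {suc n} {f} {g} f≤g ∑f≡∑g zero = ≤-antisym (f≤g zero)
  (+-cancelʳ-≤ (sum (f ∘ suc)) (g zero) (f zero)
    (≤-trans (+-monoʳ-≤ (g zero) (sum-mono-≤ (f≤g ∘ suc))) (≤-reflexive (sym ∑f≡∑g))))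
sum-≡⇒≗ {suc n} {f} {g} f≤g ∑f≡∑g (suc i) = sum-≡⇒≗ (f≤g ∘ suc)
  (+-cancelˡ-≡ (f zero) _ _ (trans ∑f≡∑g (cong (_+ sum (g ∘ suc)) (sym (sum-≡⇒≗ f≤g ∑f≡∑g zero)))))
  i

sum-δ : ∀ {n} (a : Fin n) (f : Fin n → ℕ) → ∑[ v < n ] (𝟙 (does (a ≟ v)) * f v) ≡ f a
sum-δ {suc n} zero    f = begin
  f zero + 0 * f zero + ∑[ v < n ] 0 ≡⟨ cong₂ _+_ (+-identityʳ (f zero)) (sum-replicate-zero n) ⟩
  f zero + 0                          ≡⟨ +-identityʳ (f zero) ⟩
  f zero                              ∎
  where open ≡-Reasoning
sum-δ {suc n} (suc a) f = sum-δ a (f ∘ suc)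

decrement : ∀ {K} (req : Fin K → ℕ) h₁ → 0 < req h₁ →
            ∃ λ req′ → (∀ h → req h ≡ 𝟙 (does (h₁ ≟ h)) + req′ h) × sum req ≡ suc (sum req′)
decrement {K} req h₁ 0<req-h₁ = req′ , req≡ , (begin
  sum req                                          ≡⟨ sum-cong-≗ req≡ ⟩
  ∑[ h < K ] (𝟙 (does (h₁ ≟ h)) + req′ h)           ≡⟨ ∑-distrib-+ (λ h → 𝟙 (does (h₁ ≟ h))) req′ ⟩
  ∑[ h < K ] 𝟙 (does (h₁ ≟ h)) + sum req′          ≡⟨ cong (_+ sum req′) ∑δ≡1 ⟩
  suc (sum req′)                                   ∎)
  where
  open ≡-Reasoning
  req′ : Fin K → ℕ
  req′ h = req h ∸ 𝟙 (does (h₁ ≟ h))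
  req≡ : ∀ h → req h ≡ 𝟙 (does (h₁ ≟ h)) + req′ h
  req≡ h with h₁ ≟ h
  ... | yes refl = sym (m+[n∸m]≡n 0<req-h₁)
  ... | no  _    = refl
  ∑δ≡1 : ∑[ h < K ] 𝟙 (does (h₁ ≟ h)) ≡ 1
  ∑δ≡1 = trans (sum-cong-≗ (λ h → sym (*-identityʳ (𝟙 (does (h₁ ≟ h)))))) (sum-δ h₁ (λ _ → 1))

∑-fibres : ∀ {n E} (π : Fin E → Fin n) (g : Fin E → ℕ) (w : Fin n → ℕ) →
           ∑[ v < n ] (w v * ∑[ e < E ] (g e * 𝟙 (does (π e ≟ v)))) ≡ ∑[ e < E ] (g e * w (π e))
∑-fibres {n} {E} π g w = begin
  ∑[ v < n ] (w v * ∑[ e < E ] (g e * δ e v))   ≡⟨ sum-cong-≗ (λ v → *-distribˡ-sum (w v) (λ e → g e * δ e v)) ⟩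
  ∑[ v < n ] ∑[ e < E ] (w v * (g e * δ e v))   ≡⟨ ∑-comm (λ v e → w v * (g e * δ e v)) ⟩
  ∑[ e < E ] ∑[ v < n ] (w v * (g e * δ e v))   ≡⟨ sum-cong-≗ (λ e → sum-cong-≗ (λ v → regroup (w v) (g e) (δ e v))) ⟩
  ∑[ e < E ] ∑[ v < n ] (δ e v * (g e * w v))   ≡⟨ sum-cong-≗ (λ e → sum-δ (π e) (λ v → g e * w v)) ⟩
  ∑[ e < E ] (g e * w (π e))                    ∎
  where
  open ≡-Reasoning
  δ : Fin E → Fin n → ℕ
  δ e v = 𝟙 (does (π e ≟ v))
  regroup : ∀ x y z → x * (y * z) ≡ z * (y * x)
  regroup x y z = trans (sym (*-assoc x y z)) (trans (*-comm (x * y) z) (cong (z *_) (*-comm x y)))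

module _ {n : ℕ} where

  infix  4 _∈_ _⊆_
  infixr 7 _∩_
  infixr 6 _∪_ _∖_

  -- A record rather than T (S x), so that S and x can be recovered by unification.
  record _∈_ (x : Fin n) (S : Fin n → Bool) : Set where
    constructor ∈-intro
    field holds : T (S x)

  _⊆_ : (Fin n → Bool) → (Fin n → Bool) → Set
  S ⊆ S′ = ∀ {x} → x ∈ S → x ∈ S′

  _∩_ _∪_ _∖_ : (Fin n → Bool) → (Fin n → Bool) → Fin n → Bool
  (S ∩ S′) x = S x ∧ S′ x
  (S ∪ S′) x = S x ∨ S′ x
  (S ∖ S′) x = S x ∧ not (S′ x)

  ⁅_⁆ : Fin n → Fin n → Bool
  ⁅ x ⁆ y = does (y ≟ x)

  ∣_∣ : (Fin n → Bool) → ℕ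
  ∣ S ∣ = sum (𝟙 ∘ S)

  support : (Fin n → ℕ) → Fin n → Bool
  support f x = 0 <ᵇ f x

  ∈⇒≡true : ∀ {S x} → x ∈ S → S x ≡ true
  ∈⇒≡true x∈S = Equivalence.to T-≡ (_∈_.holds x∈S)

  ≡true⇒∈ : ∀ {S x} → S x ≡ true → x ∈ S
  ≡true⇒∈ Sx≡true = ∈-intro (Equivalence.from T-≡ Sx≡true)

  ∩⁺ : ∀ {S S′ x} → x ∈ S → x ∈ S′ → x ∈ S ∩ S′
  ∩⁺ (∈-intro x∈S) (∈-intro x∈S′) = ∈-intro (Equivalence.from T-∧ (x∈S , x∈S′))

  ∩⁻ : ∀ {S S′ x} → x ∈ S ∩ S′ → x ∈ S × x ∈ S′
  ∩⁻ (∈-intro x∈S∩S′) = let x∈S , x∈S′ = Equivalence.to T-∧ x∈S∩S′ in ∈-intro x∈S , ∈-intro x∈S′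

  ∪⁺ : ∀ {S S′ x} → x ∈ S ⊎ x ∈ S′ → x ∈ S ∪ S′
  ∪⁺ (inj₁ (∈-intro x∈S))  = ∈-intro (Equivalence.from T-∨ (inj₁ x∈S))
  ∪⁺ (inj₂ (∈-intro x∈S′)) = ∈-intro (Equivalence.from T-∨ (inj₂ x∈S′))

  ∪⁻ : ∀ {S S′ x} → x ∈ S ∪ S′ → x ∈ S ⊎ x ∈ S′
  ∪⁻ (∈-intro x∈S∪S′) with Equivalence.to T-∨ x∈S∪S′
  ... | inj₁ x∈S  = inj₁ (∈-intro x∈S)
  ... | inj₂ x∈S′ = inj₂ (∈-intro x∈S′)

  ∉⇒≡false : ∀ {S x} → ¬ x ∈ S → S x ≡ false
  ∉⇒≡false {S} {x} x∉S with S x in Sx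
  ... | false = refl
  ... | true  = contradiction (≡true⇒∈ Sx) x∉S

  ∖⁺ : ∀ {S S′ x} → x ∈ S → ¬ x ∈ S′ → x ∈ S ∖ S′
  ∖⁺ x∈S x∉S′ = ≡true⇒∈ (cong₂ (λ a b → a ∧ not b) (∈⇒≡true x∈S) (∉⇒≡false x∉S′))

  ∖⁻ : ∀ {S S′ x} → x ∈ S ∖ S′ → x ∈ S × ¬ x ∈ S′
  ∖⁻ {S} {S′} {x} (∈-intro x∈S∖S′) =
    let x∈S , x∉S′ = Equivalence.to (T-∧ {S x}) x∈S∖S′
    in ∈-intro x∈S , λ x∈S′ → subst (T ∘ not) (∈⇒≡true x∈S′) x∉S′

  x∈⁅x⁆ : ∀ x → x ∈ ⁅ x ⁆
  x∈⁅x⁆ x = ≡true⇒∈ (dec-true (x ≟ x) refl)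

  x∈⁅y⁆⇒x≡y : ∀ {x y} → x ∈ ⁅ y ⁆ → x ≡ y
  x∈⁅y⁆⇒x≡y {x} {y} x∈⁅y⁆ with x ≟ y | ∈⇒≡true x∈⁅y⁆
  ... | yes x≡y | _ = x≡y
  ... | no  _   | ()

  _∈?_ : ∀ x S → Dec (x ∈ S)
  x ∈? S = map′ ∈-intro _∈_.holds (T? (S x))

  ⊆⇒∩≗ˡ : ∀ {S S′} → S ⊆ S′ → S ∩ S′ ≗ S
  ⊆⇒∩≗ˡ {S} {S′} S⊆S′ x with S x in Sx
  ... | false = refl
  ... | true  = ∈⇒≡true (S⊆S′ (≡true⇒∈ Sx))

  ⊆⇒∩≗ʳ : ∀ {S S′} → S ⊆ S′ → S′ ∩ S ≗ S
  ⊆⇒∩≗ʳ {S} {S′} S⊆S′ x = trans (∧-comm (S′ x) (S x)) (⊆⇒∩≗ˡ S⊆S′ x)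

  ∣∣-cong : ∀ {S S′} → S ≗ S′ → ∣ S ∣ ≡ ∣ S′ ∣
  ∣∣-cong S≗S′ = sum-cong-≗ (cong 𝟙 ∘ S≗S′)

  ∣∣-mono : ∀ {S S′} → S ⊆ S′ → ∣ S ∣ ≤ ∣ S′ ∣
  ∣∣-mono {S} {S′} S⊆S′ = sum-mono-≤ 𝟙-mono
    where
    𝟙-mono : ∀ x → 𝟙 (S x) ≤ 𝟙 (S′ x)
    𝟙-mono x with S x in Sx
    ... | false = z≤n
    ... | true  = ≤-reflexive (cong 𝟙 (sym (∈⇒≡true (S⊆S′ (≡true⇒∈ Sx)))))

  ∣∣-positive : ∀ {S x} → x ∈ S → 0 < ∣ S ∣
  ∣∣-positive {S} {x} x∈S = ≤-trans (≤-reflexive (cong 𝟙 (sym (∈⇒≡true x∈S)))) (term≤sum (𝟙 ∘ S) x)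

  ∣∣-positive⁻ : ∀ S → 0 < ∣ S ∣ → ∃ (_∈ S)
  ∣∣-positive⁻ S 0<∣S∣ with sum-positive (𝟙 ∘ S) 0<∣S∣
  ... | x , 0<𝟙 with S x in Sx
  ...   | true = x , ≡true⇒∈ Sx

  ∣∣-empty : ∀ {S} → (∀ {x} → ¬ x ∈ S) → ∣ S ∣ ≡ 0
  ∣∣-empty {S} ∅ = n≤0⇒n≡0 (≤-trans (∣∣-mono {S′ = λ _ → false} (λ x∈S → contradiction x∈S ∅))
                                     (≤-reflexive (sum-replicate-zero n)))

∣⁅x⁆∣≡1 : ∀ {n} (x : Fin n) → ∣ ⁅ x ⁆ ∣ ≡ 1
∣⁅x⁆∣≡1 {suc n} zero    = cong suc (sum-replicate-zero n)
∣⁅x⁆∣≡1 {suc n} (suc x) = ∣⁅x⁆∣≡1 x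

module _ {n : ℕ} where

  ∣∣-split : ∀ (S S′ : Fin n → Bool) → ∣ S ∣ ≡ ∣ S ∩ S′ ∣ + ∣ S ∖ S′ ∣
  ∣∣-split S S′ = trans (sum-cong-≗ pointwise) (∑-distrib-+ (𝟙 ∘ (S ∩ S′)) (𝟙 ∘ (S ∖ S′)))
    where
    pointwise : ∀ x → 𝟙 (S x) ≡ 𝟙 ((S ∩ S′) x) + 𝟙 ((S ∖ S′) x)
    pointwise x with S x | S′ x
    ... | true  | true  = refl
    ... | true  | false = refl
    ... | false | _     = refl

  ∣∪∣+∣∩∣ : ∀ (S S′ : Fin n → Bool) → ∣ S ∪ S′ ∣ + ∣ S ∩ S′ ∣ ≡ ∣ S ∣ + ∣ S′ ∣
  ∣∪∣+∣∩∣ S S′ = begin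
    ∣ S ∪ S′ ∣ + ∣ S ∩ S′ ∣                         ≡⟨ ∑-distrib-+ (𝟙 ∘ (S ∪ S′)) (𝟙 ∘ (S ∩ S′)) ⟨
    ∑[ x < n ] (𝟙 ((S ∪ S′) x) + 𝟙 ((S ∩ S′) x))    ≡⟨ sum-cong-≗ pointwise ⟩
    ∑[ x < n ] (𝟙 (S x) + 𝟙 (S′ x))                 ≡⟨ ∑-distrib-+ (𝟙 ∘ S) (𝟙 ∘ S′) ⟩
    ∣ S ∣ + ∣ S′ ∣                                   ∎
    where
    open ≡-Reasoning
    pointwise : ∀ x → 𝟙 ((S ∪ S′) x) + 𝟙 ((S ∩ S′) x) ≡ 𝟙 (S x) + 𝟙 (S′ x)
    pointwise x with S x | S′ x
    ... | true  | true  = refl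
    ... | true  | false = refl
    ... | false | true  = refl
    ... | false | false = refl

  ∣S∣≡1+∣S∖⁅x⁆∣ : ∀ {S x} → x ∈ S → ∣ S ∣ ≡ suc ∣ S ∖ ⁅ x ⁆ ∣
  ∣S∣≡1+∣S∖⁅x⁆∣ {S} {x} x∈S = trans (∣∣-split S ⁅ x ⁆) (cong (_+ ∣ S ∖ ⁅ x ⁆ ∣) ∣S∩⁅x⁆∣≡1)
    where
    ⁅x⁆⊆S : ⁅ x ⁆ ⊆ S
    ⁅x⁆⊆S y∈⁅x⁆ = subst (_∈ S) (sym (x∈⁅y⁆⇒x≡y y∈⁅x⁆)) x∈S
    ∣S∩⁅x⁆∣≡1 : ∣ S ∩ ⁅ x ⁆ ∣ ≡ 1
    ∣S∩⁅x⁆∣≡1 = trans (∣∣-cong (⊆⇒∩≗ʳ ⁅x⁆⊆S)) (∣⁅x⁆∣≡1 x)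

  ∣S∖⁅x⁆∣<∣S∣ : ∀ {S x} → x ∈ S → ∣ S ∖ ⁅ x ⁆ ∣ < ∣ S ∣
  ∣S∖⁅x⁆∣<∣S∣ x∈S = ≤-reflexive (sym (∣S∣≡1+∣S∖⁅x⁆∣ x∈S))

  ∣∣≤1 : ∀ {S} → (∀ {x y} → x ∈ S → y ∈ S → x ≡ y) → ∣ S ∣ ≤ 1
  ∣∣≤1 {S} unique with ∣ S ∣ in ∣S∣
  ... | zero  = z≤n
  ... | suc k with ∣∣-positive⁻ S (subst (0 <_) (sym ∣S∣) z<s)
  ...   | x , x∈S = ≤-trans (≤-reflexive (trans (sym ∣S∣) (∣S∣≡1+∣S∖⁅x⁆∣ x∈S)))
                            (s≤s (≤-reflexive (∣∣-empty only-x)))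
    where
    only-x : ∀ {y} → ¬ y ∈ S ∖ ⁅ x ⁆
    only-x y∈S∖⁅x⁆ = let y∈S , y∉⁅x⁆ = ∖⁻ y∈S∖⁅x⁆ in
      y∉⁅x⁆ (subst (_∈ ⁅ x ⁆) (unique x∈S y∈S) (x∈⁅x⁆ x))

∈-∘ : ∀ {m n} {f : Fin m → Fin n} {S x} → f x ∈ S → x ∈ S ∘ f
∈-∘ (∈-intro fx∈S) = ∈-intro fx∈S

∈-∘⁻ : ∀ {m n} {f : Fin m → Fin n} {S x} → x ∈ S ∘ f → f x ∈ S
∈-∘⁻ (∈-intro x∈S∘f) = ∈-intro x∈S∘f

fibre : ∀ {n E} → (Fin E → Fin n) → Fin n → Fin E → Bool
fibre end v = ⁅ v ⁆ ∘ end

e∈fibre : ∀ {n E} (end : Fin E → Fin n) e → e ∈ fibre end (end e)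
e∈fibre end e = ∈-∘ {f = end} (x∈⁅x⁆ (end e))

fibre⁻ : ∀ {n E} (end : Fin E → Fin n) {e v} → e ∈ fibre end v → end e ≡ v
fibre⁻ end = x∈⁅y⁆⇒x≡y ∘ ∈-∘⁻ {f = end}

module _ {n E : ℕ} (end : Fin E → Fin n) where

  deg : (Fin E → Bool) → Fin n → ℕ
  deg A v = ∣ A ∩ fibre end v ∣

  deg-cong : ∀ {A A′} → A ≗ A′ → ∀ v → deg A v ≡ deg A′ v
  deg-cong A≗A′ v = ∣∣-cong (λ e → cong (_∧ fibre end v e) (A≗A′ e))

  deg-mono : ∀ {A A′} → A ⊆ A′ → ∀ v → deg A v ≤ deg A′ v
  deg-mono A⊆A′ v = ∣∣-mono (λ e∈ → let e∈A , e∈fib = ∩⁻ e∈ in ∩⁺ (A⊆A′ e∈A) e∈fib)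

  deg-positive : ∀ {A e} → e ∈ A → 0 < deg A (end e)
  deg-positive {e = e} e∈A = ∣∣-positive (∩⁺ e∈A (e∈fibre end e))

  deg-split : ∀ A M v → deg A v ≡ deg (A ∩ M) v + deg (A ∖ M) v
  deg-split A M v = trans (∣∣-split (A ∩ fibre end v) M)
    (cong₂ _+_ (∣∣-cong {S = (A ∩ fibre end v) ∩ M} (λ e → ∧-swapʳ (A e) (fibre end v e) (M e)))
               (∣∣-cong {S = (A ∩ fibre end v) ∖ M} (λ e → ∧-swapʳ (A e) (fibre end v e) (not (M e)))))
    where
    ∧-swapʳ : ∀ x y z → (x ∧ y) ∧ z ≡ (x ∧ z) ∧ y
    ∧-swapʳ false y z = refl
    ∧-swapʳ true  y z = ∧-comm y z

  ∑-weighted-deg : ∀ A (w : Fin n → ℕ) → ∑[ v < n ] (w v * deg A v) ≡ ∑[ e < E ] (𝟙 (A e) * w (end e))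
  ∑-weighted-deg A w = trans (sum-cong-≗ (λ v → cong (w v *_) (sum-cong-≗ (λ e → 𝟙-∧ (A e) _))))
                             (∑-fibres end (𝟙 ∘ A) w)

  handshake : ∀ A → ∑[ v < n ] deg A v ≡ ∣ A ∣
  handshake A = begin
    ∑[ v < n ] deg A v             ≡⟨ sum-cong-≗ (λ v → sym (*-identityˡ (deg A v))) ⟩
    ∑[ v < n ] (1 * deg A v)       ≡⟨ ∑-weighted-deg A (λ _ → 1) ⟩
    ∑[ e < E ] (𝟙 (A e) * 1)       ≡⟨ sum-cong-≗ (λ e → *-identityʳ (𝟙 (A e))) ⟩
    ∣ A ∣                          ∎
    where open ≡-Reasoning

  ∑-deg-restricted : ∀ A S → ∑[ v < n ] (𝟙 (S v) * deg A v) ≡ ∣ A ∩ S ∘ end ∣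
  ∑-deg-restricted A S = trans (∑-weighted-deg A (𝟙 ∘ S)) (sum-cong-≗ (λ e → sym (𝟙-∧ (A e) (S (end e)))))

  RegularAt : ℕ → (Fin E → Bool) → Set
  RegularAt d A = ∀ v → deg A v ≡ 0 ⊎ deg A v ≡ d

  regular-≤ : ∀ {d A} → RegularAt d A → ∀ v → deg A v ≤ d
  regular-≤ regular v with regular v
  ... | inj₁ ≡0 = ≤-trans (≤-reflexive ≡0) z≤n
  ... | inj₂ ≡d = ≤-reflexive ≡d

  regular-deg : ∀ {d A} → RegularAt (suc d) A → ∀ v → deg A v ≡ suc d * 𝟙 (support (deg A) v)
  regular-deg {d} {A} regular v with deg A v | regular v
  ... | _ | inj₁ refl = sym (*-zeroʳ (suc d))
  ... | _ | inj₂ refl = sym (*-identityʳ (suc d))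

  PerfectAt : (Fin E → Bool) → (Fin E → Bool) → Set
  PerfectAt A M = ∀ v → deg M v ≡ 𝟙 (support (deg A) v)

  deg-∖-perfect : ∀ {d A M v} → M ⊆ A → PerfectAt A M → deg A v ≡ suc d → deg (A ∖ M) v ≡ d
  deg-∖-perfect {d} {A} {M} {v} M⊆A perfect deg≡ = suc-injective (begin
    suc (deg (A ∖ M) v)              ≡⟨ cong (_+ deg (A ∖ M) v) (trans (perfect v) (cong (𝟙 ∘ (0 <ᵇ_)) deg≡)) ⟨
    deg M v + deg (A ∖ M) v          ≡⟨ cong (_+ deg (A ∖ M) v) (deg-cong (⊆⇒∩≗ʳ M⊆A) v) ⟨
    deg (A ∩ M) v + deg (A ∖ M) v    ≡⟨ deg-split A M v ⟨
    deg A v                          ≡⟨ deg≡ ⟩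
    suc d                            ∎)
    where open ≡-Reasoning

  regular-∖ : ∀ {d A M} → RegularAt (suc d) A → M ⊆ A → PerfectAt A M → RegularAt d (A ∖ M)
  regular-∖ regular M⊆A perfect v with regular v
  ... | inj₁ deg≡0 = inj₁ (n≤0⇒n≡0 (≤-trans (deg-mono (proj₁ ∘ ∖⁻) v) (≤-reflexive deg≡0)))
  ... | inj₂ deg≡d = inj₂ (deg-∖-perfect M⊆A perfect deg≡d)

  ∑-regular : ∀ {d A} → RegularAt (suc d) A → ∑[ v < n ] deg A v ≡ suc d * ∣ support (deg A) ∣
  ∑-regular {d} {A} regular = trans (sum-cong-≗ (regular-deg regular)) (sym (*-distribˡ-sum (suc d) (𝟙 ∘ support (deg A))))

  SplitsAt : ∀ {K} → ℕ → (Fin E → Bool) → (Fin K → ℕ) → (Fin E → Fin K) → Set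
  SplitsAt d A req c = ∀ h v → deg A v ≡ d → deg (A ∩ fibre c h) v ≡ req h

  splits-zero : ∀ {K} A (req : Fin K → ℕ) c → sum req ≡ 0 → SplitsAt 0 A req c
  splits-zero A req c ∑req≡0 h v deg≡0 = trans
    (n≤0⇒n≡0 (≤-trans (deg-mono (proj₁ ∘ ∩⁻) v) (≤-reflexive deg≡0)))
    (sym (n≤0⇒n≡0 (≤-trans (term≤sum req h) (≤-reflexive ∑req≡0))))

  splits-positive : ∀ {K d A} {req : Fin K → ℕ} {c} → RegularAt d A → SplitsAt d A req c → ∀ {e} → e ∈ A → 0 < req (c e)
  splits-positive {A = A} {req} {c} regular splits {e} e∈A with regular (end e)
  ... | inj₁ deg≡0 = contradiction (subst (0 <_) deg≡0 (deg-positive e∈A)) n≮0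
  ... | inj₂ deg≡d = subst (0 <_) (splits (c e) (end e) deg≡d) (deg-positive (∩⁺ e∈A (e∈fibre c e)))

  splits-extend : ∀ {K d A M} {req req′ : Fin K → ℕ} {h₁ c′} → M ⊆ A → PerfectAt A M →
                  (∀ h → req h ≡ 𝟙 (does (h₁ ≟ h)) + req′ h) →
                  SplitsAt d (A ∖ M) req′ c′ →
                  SplitsAt (suc d) A req (λ e → if M e then h₁ else c′ e)
  splits-extend {K} {d} {A} {M} {req} {req′} {h₁} {c′} M⊆A perfect req≡ splits′ h v deg≡ = begin
    deg (A ∩ fibre c h) v                                       ≡⟨ deg-split (A ∩ fibre c h) M v ⟩
    deg ((A ∩ fibre c h) ∩ M) v + deg ((A ∩ fibre c h) ∖ M) v   ≡⟨ cong₂ _+_ on-M (deg-cong off-M v) ⟩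
    𝟙 (does (h₁ ≟ h)) + deg ((A ∖ M) ∩ fibre c′ h) v            ≡⟨ cong (𝟙 (does (h₁ ≟ h)) +_)
                                                                     (splits′ h v (deg-∖-perfect M⊆A perfect deg≡)) ⟩
    𝟙 (does (h₁ ≟ h)) + req′ h                                  ≡⟨ req≡ h ⟨
    req h                                                       ∎
    where
    open ≡-Reasoning
    c : Fin E → Fin K
    c e = if M e then h₁ else c′ e
    off-M : (A ∩ fibre c h) ∖ M ≗ (A ∖ M) ∩ fibre c′ h
    off-M e with M e
    ... | true  = trans (∧-zeroʳ _) (sym (cong (_∧ fibre c′ h e) (∧-zeroʳ (A e))))
    ... | false = trans (∧-identityʳ _) (sym (cong (_∧ fibre c′ h e) (∧-identityʳ (A e))))
    on-M : deg ((A ∩ fibre c h) ∩ M) v ≡ 𝟙 (does (h₁ ≟ h))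
    on-M with h₁ ≟ h
    ... | yes refl = trans (deg-cong M-coloured v) (trans (perfect v) (cong (𝟙 ∘ (0 <ᵇ_)) deg≡))
      where
      M-coloured : (A ∩ fibre c h₁) ∩ M ≗ M
      M-coloured e with M e in Me
      ... | false = ∧-zeroʳ _
      ... | true  = trans (∧-identityʳ _) (cong₂ _∧_ (∈⇒≡true (M⊆A (≡true⇒∈ Me))) (dec-true (h₁ ≟ h₁) refl))
    ... | no h₁≢h = trans (deg-cong M-uncoloured v) (∣∣-empty {S = (λ _ → false) ∩ fibre end v} λ { (∈-intro ()) })
      where
      M-uncoloured : (A ∩ fibre c h) ∩ M ≗ (λ _ → false)
      M-uncoloured e with M e
      ... | false = ∧-zeroʳ _
      ... | true  = trans (∧-identityʳ _) (trans (cong (A e ∧_) (dec-false (h₁ ≟ h) h₁≢h)) (∧-zeroʳ (A e)))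

-- Hall's theorem and König's decomposition for bipartite multigraphs

module BipartiteMultigraph {a b E : ℕ} (left : Fin E → Fin a) (right : Fin E → Fin b) where

  nbr : (Fin E → Bool) → (Fin a → Bool) → Fin b → Bool
  nbr A S = support (deg right (A ∩ S ∘ left))

  nbr⁺ : ∀ {A S e} → e ∈ A → left e ∈ S → right e ∈ nbr A S
  nbr⁺ e∈A le∈S = ∈-intro (<⇒<ᵇ (deg-positive right (∩⁺ e∈A (∈-∘ {f = left} le∈S))))

  nbr⁻ : ∀ A S {y} → y ∈ nbr A S → ∃ λ e → e ∈ A × left e ∈ S × right e ≡ y
  nbr⁻ A S {y} (∈-intro y∈N)
    with ∣∣-positive⁻ ((A ∩ S ∘ left) ∩ fibre right y) (<ᵇ⇒< 0 (deg right (A ∩ S ∘ left) y) y∈N)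
  ... | e , e∈ = let e∈A∩S∘left , e∈fib = ∩⁻ e∈ ; e∈A , e∈S∘left = ∩⁻ e∈A∩S∘left
                 in e , e∈A , ∈-∘⁻ {f = left} e∈S∘left , fibre⁻ right e∈fib

  nbr-cong : ∀ A {S S′} → S ≗ S′ → nbr A S ≗ nbr A S′
  nbr-cong A S≗S′ y = cong (0 <ᵇ_) (deg-cong right (λ e → cong (A e ∧_) (S≗S′ (left e))) y)

  HallCondition : (Fin a → Bool) → (Fin E → Bool) → Set
  HallCondition X A = ∀ S → S ⊆ X → ∣ S ∣ ≤ ∣ nbr A S ∣

  hall? : ∀ X A → HallCondition X A ⊎ ∃ λ S → S ⊆ X × ∣ nbr A S ∣ < ∣ S ∣
  hall? X A with anySubset? (λ V → ∣ nbr A (lookup V ∩ X) ∣ <? ∣ lookup V ∩ X ∣)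
  ... | yes (V , violation) = inj₂ (lookup V ∩ X , proj₂ ∘ ∩⁻ , violation)
  ... | no  no-violation    = inj₁ λ S S⊆X → ≮⇒≥ λ violation → no-violation
          (tabulate S , subst₂ _<_ (∣∣-cong (nbr-cong A (restrict S S⊆X))) (∣∣-cong (restrict S S⊆X)) violation)
    where
    restrict : ∀ S → S ⊆ X → S ≗ lookup (tabulate S) ∩ X
    restrict S S⊆X x = trans (sym (⊆⇒∩≗ˡ S⊆X x)) (cong (_∧ X x) (sym (lookup∘tabulate S x)))

  SaturatingMatching : (Fin a → Bool) → (Fin E → Bool) → (Fin E → Bool) → Set
  SaturatingMatching X A M = M ⊆ A × (∀ x → deg left M x ≡ 𝟙 (X x)) × (∀ y → deg right M y ≤ 1)

  module HallBase {X : Fin a → Bool} {A : Fin E → Bool} (hall : HallCondition X A)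
                  (unique : ∀ {e e′} → e ∈ A → e′ ∈ A → left e ∈ X → left e ≡ left e′ → e ≡ e′) where

    M : Fin E → Bool
    M = A ∩ X ∘ left

    M⁻ : ∀ {e} → e ∈ M → e ∈ A × left e ∈ X
    M⁻ e∈M = let e∈A , e∈X∘left = ∩⁻ e∈M in e∈A , ∈-∘⁻ {f = left} e∈X∘left

    M-unique : ∀ {e e′} → e ∈ M → e′ ∈ M → left e ≡ left e′ → e ≡ e′
    M-unique e∈M e′∈M = unique (proj₁ (M⁻ e∈M)) (proj₁ (M⁻ e′∈M)) (proj₂ (M⁻ e∈M))

    edge-at : ∀ x → x ∈ X → ∃ λ e → e ∈ M × left e ≡ x
    edge-at x x∈X with ∣∣-positive⁻ (nbr A ⁅ x ⁆) (≤-trans (≤-reflexive (sym (∣⁅x⁆∣≡1 x))) (hall ⁅ x ⁆ ⁅x⁆⊆X))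
      where
      ⁅x⁆⊆X : ⁅ x ⁆ ⊆ X
      ⁅x⁆⊆X y∈⁅x⁆ = subst (_∈ X) (sym (x∈⁅y⁆⇒x≡y y∈⁅x⁆)) x∈X
    ... | _ , y∈N with nbr⁻ A ⁅ x ⁆ y∈N
    ...   | e , e∈A , le∈⁅x⁆ , _ = let le≡x = x∈⁅y⁆⇒x≡y le∈⁅x⁆ in
      e , ∩⁺ e∈A (∈-∘ {f = left} (subst (_∈ X) (sym le≡x) x∈X)) , le≡x

    deg-left : ∀ x → deg left M x ≡ 𝟙 (X x)
    deg-left x with X x in Xx
    ... | false = ∣∣-empty λ e∈ → let e∈M , e∈fib = ∩⁻ e∈ in
        contradiction (trans (sym Xx) (∈⇒≡true (subst (_∈ X) (fibre⁻ left e∈fib) (proj₂ (M⁻ e∈M))))) λ ()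
    ... | true with edge-at x (≡true⇒∈ Xx)
    ...   | e , e∈M , refl = ≤-antisym (∣∣≤1 at-most-one) (∣∣-positive (∩⁺ e∈M (e∈fibre left e)))
      where
      at-most-one : ∀ {f f′} → f ∈ M ∩ fibre left (left e) → f′ ∈ M ∩ fibre left (left e) → f ≡ f′
      at-most-one f∈ f′∈ = let f∈M , f∈fib = ∩⁻ f∈ ; f′∈M , f′∈fib = ∩⁻ f′∈
                           in M-unique f∈M f′∈M (trans (fibre⁻ left f∈fib) (sym (fibre⁻ left f′∈fib)))

    distinct-heads : ∀ {e e′} → e ∈ M → e′ ∈ M → e ≢ e′ → right e ≢ right e′
    distinct-heads {e} {e′} e∈M e′∈M e≢e′ re≡re′ =
      contradiction (≤-trans (≤-reflexive (sym ∣S∣≡2)) (≤-trans (hall S S⊆X) (≤-trans (∣∣-mono N⊆⁅re⁆) (≤-reflexive (∣⁅x⁆∣≡1 (right e))))))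
                    λ { (s≤s ()) }
      where
      S : Fin a → Bool
      S = ⁅ left e ⁆ ∪ ⁅ left e′ ⁆
      S⁻ : ∀ {x} → x ∈ S → ∃ λ f → f ∈ M × (f ≡ e ⊎ f ≡ e′) × left f ≡ x
      S⁻ x∈S with ∪⁻ x∈S
      ... | inj₁ x∈⁅le⁆  = e  , e∈M  , inj₁ refl , sym (x∈⁅y⁆⇒x≡y x∈⁅le⁆)
      ... | inj₂ x∈⁅le′⁆ = e′ , e′∈M , inj₂ refl , sym (x∈⁅y⁆⇒x≡y x∈⁅le′⁆)
      S⊆X : S ⊆ X
      S⊆X x∈S = let f , f∈M , _ , lf≡x = S⁻ x∈S in subst (_∈ X) lf≡x (proj₂ (M⁻ f∈M))
      ∣S∣≡2 : ∣ S ∣ ≡ 2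
      ∣S∣≡2 = begin
        ∣ S ∣                                  ≡⟨ +-identityʳ ∣ S ∣ ⟨
        ∣ S ∣ + 0                              ≡⟨ cong (∣ S ∣ +_) (∣∣-empty disjoint) ⟨
        ∣ S ∣ + ∣ ⁅ left e ⁆ ∩ ⁅ left e′ ⁆ ∣    ≡⟨ ∣∪∣+∣∩∣ ⁅ left e ⁆ ⁅ left e′ ⁆ ⟩
        ∣ ⁅ left e ⁆ ∣ + ∣ ⁅ left e′ ⁆ ∣        ≡⟨ cong₂ _+_ (∣⁅x⁆∣≡1 (left e)) (∣⁅x⁆∣≡1 (left e′)) ⟩
        2                                      ∎
        where
        open ≡-Reasoning
        disjoint : ∀ {x} → ¬ x ∈ ⁅ left e ⁆ ∩ ⁅ left e′ ⁆
        disjoint x∈ = let x∈⁅le⁆ , x∈⁅le′⁆ = ∩⁻ x∈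
                      in e≢e′ (M-unique e∈M e′∈M (trans (sym (x∈⁅y⁆⇒x≡y x∈⁅le⁆)) (x∈⁅y⁆⇒x≡y x∈⁅le′⁆)))
      N⊆⁅re⁆ : nbr A S ⊆ ⁅ right e ⁆
      N⊆⁅re⁆ z∈N with nbr⁻ A S z∈N
      ... | f , f∈A , lf∈S , refl with S⁻ lf∈S
      ...   | g , g∈M , g≡e∨e′ , lg≡lf =
        let f≡g = unique f∈A (proj₁ (M⁻ g∈M)) (S⊆X lf∈S) (sym lg≡lf)
            rg≡re = [ cong right , (λ g≡e′ → trans (cong right g≡e′) (sym re≡re′)) ]′ g≡e∨e′
        in subst (_∈ ⁅ right e ⁆) (sym (trans (cong right f≡g) rg≡re)) (x∈⁅x⁆ (right e))

    deg-right : ∀ y → deg right M y ≤ 1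
    deg-right y = ∣∣≤1 λ {e} {e′} e∈ e′∈ → let e∈M , e∈fib = ∩⁻ e∈ ; e′∈M , e′∈fib = ∩⁻ e′∈ in
      decidable-stable (e ≟ e′) (λ e≢e′ → distinct-heads e∈M e′∈M e≢e′ (trans (fibre⁻ right e∈fib) (sym (fibre⁻ right e′∈fib))))

  hall-base : ∀ {X A} → HallCondition X A →
              (∀ {e e′} → e ∈ A → e′ ∈ A → left e ∈ X → left e ≡ left e′ → e ≡ e′) →
              SaturatingMatching X A (A ∩ X ∘ left)
  hall-base hall unique = proj₁ ∘ ∩⁻ , deg-left , deg-right
    where open HallBase hall unique

  violator-∋-left : ∀ {X A e S} → HallCondition X A → S ⊆ X → ∣ nbr (A ∖ ⁅ e ⁆) S ∣ < ∣ S ∣ → left e ∈ S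
  violator-∋-left {X} {A} {e} {S} hall S⊆X violation with S (left e) in Sle
  ... | true  = ≡true⇒∈ Sle
  ... | false = contradiction (≤-trans (hall S S⊆X) (∣∣-mono N⊆N∖e)) (<⇒≱ violation)
    where
    N⊆N∖e : nbr A S ⊆ nbr (A ∖ ⁅ e ⁆) S
    N⊆N∖e y∈N with nbr⁻ A S y∈N
    ... | f , f∈A , lf∈S , refl = nbr⁺ (∖⁺ f∈A λ f∈⁅e⁆ →
          contradiction (trans (sym Sle) (∈⇒≡true (subst (λ g → left g ∈ S) (x∈⁅y⁆⇒x≡y f∈⁅e⁆) lf∈S))) λ ())
          lf∈S

  -- Both violators contain x = left e₁ = left e₂, and then S₁ ∪ S₂ and (S₁ ∩ S₂) ∖ ⁅ x ⁆ together
  -- have fewer neighbours in A than Hall's condition allows.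
  module TwoViolators {X : Fin a → Bool} {A : Fin E → Bool} {e₁ e₂ : Fin E} {S₁ S₂ : Fin a → Bool}
                      (hall : HallCondition X A) (e₁≢e₂ : e₁ ≢ e₂) (le₁≡le₂ : left e₁ ≡ left e₂)
                      (S₁⊆X : S₁ ⊆ X) (violation₁ : ∣ nbr (A ∖ ⁅ e₁ ⁆) S₁ ∣ < ∣ S₁ ∣)
                      (S₂⊆X : S₂ ⊆ X) (violation₂ : ∣ nbr (A ∖ ⁅ e₂ ⁆) S₂ ∣ < ∣ S₂ ∣) where

    x : Fin a
    x = left e₁

    U I : Fin a → Bool
    U = S₁ ∪ S₂
    I = (S₁ ∩ S₂) ∖ ⁅ x ⁆

    N₁ N₂ : Fin b → Bool
    N₁ = nbr (A ∖ ⁅ e₁ ⁆) S₁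
    N₂ = nbr (A ∖ ⁅ e₂ ⁆) S₂

    x∈S₁ : x ∈ S₁
    x∈S₁ = violator-∋-left hall S₁⊆X violation₁

    x∈S₂ : x ∈ S₂
    x∈S₂ = subst (_∈ S₂) (sym le₁≡le₂) (violator-∋-left hall S₂⊆X violation₂)

    ∈N₁ : ∀ {f} → f ∈ A → f ≢ e₁ → left f ∈ S₁ → right f ∈ N₁
    ∈N₁ f∈A f≢e₁ = nbr⁺ {A ∖ ⁅ e₁ ⁆} {S₁} (∖⁺ f∈A (f≢e₁ ∘ x∈⁅y⁆⇒x≡y))

    ∈N₂ : ∀ {f} → f ∈ A → f ≢ e₂ → left f ∈ S₂ → right f ∈ N₂
    ∈N₂ f∈A f≢e₂ = nbr⁺ {A ∖ ⁅ e₂ ⁆} {S₂} (∖⁺ f∈A (f≢e₂ ∘ x∈⁅y⁆⇒x≡y))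

    nbr-U⊆N₁∪N₂ : nbr A U ⊆ N₁ ∪ N₂
    nbr-U⊆N₁∪N₂ y∈N with nbr⁻ A U y∈N
    ... | f , f∈A , lf∈U , refl with f ≟ e₁ | ∪⁻ {S = S₁} lf∈U
    ...   | yes refl | _          = ∪⁺ {S = N₁} (inj₂ (∈N₂ f∈A e₁≢e₂ x∈S₂))
    ...   | no  f≢e₁ | inj₁ lf∈S₁ = ∪⁺ {S = N₁} (inj₁ (∈N₁ f∈A f≢e₁ lf∈S₁))
    ...   | no  f≢e₁ | inj₂ lf∈S₂ with f ≟ e₂
    ...     | yes refl = ∪⁺ {S = N₁} (inj₁ (∈N₁ f∈A f≢e₁ (subst (_∈ S₁) le₁≡le₂ x∈S₁)))
    ...     | no  f≢e₂ = ∪⁺ {S = N₁} (inj₂ (∈N₂ f∈A f≢e₂ lf∈S₂))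

    nbr-I⊆N₁∩N₂ : nbr A I ⊆ N₁ ∩ N₂
    nbr-I⊆N₁∩N₂ y∈N with nbr⁻ A I y∈N
    ... | f , f∈A , lf∈I , refl =
      let lf∈S₁∩S₂ , lf∉⁅x⁆ = ∖⁻ {S = S₁ ∩ S₂} lf∈I ; lf∈S₁ , lf∈S₂ = ∩⁻ {S = S₁} lf∈S₁∩S₂
          f≢e₁ = λ f≡e₁ → lf∉⁅x⁆ (subst (λ g → left g ∈ ⁅ x ⁆) (sym f≡e₁) (x∈⁅x⁆ x))
          f≢e₂ = λ f≡e₂ → lf∉⁅x⁆ (subst (_∈ ⁅ x ⁆) (trans le₁≡le₂ (cong left (sym f≡e₂))) (x∈⁅x⁆ x))
      in ∩⁺ {S = N₁} (∈N₁ f∈A f≢e₁ lf∈S₁) (∈N₂ f∈A f≢e₂ lf∈S₂)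

    impossible : ⊥
    impossible = <-irrefl refl (begin
      suc (suc (∣ U ∣ + ∣ I ∣))                     ≤⟨ s≤s (s≤s (+-mono-≤ (hall U U⊆X) (hall I I⊆X))) ⟩
      suc (suc (∣ nbr A U ∣ + ∣ nbr A I ∣))         ≤⟨ s≤s (s≤s (+-mono-≤ (∣∣-mono nbr-U⊆N₁∪N₂) (∣∣-mono nbr-I⊆N₁∩N₂))) ⟩
      suc (suc (∣ N₁ ∪ N₂ ∣ + ∣ N₁ ∩ N₂ ∣))         ≡⟨ cong (2 +_) (∣∪∣+∣∩∣ N₁ N₂) ⟩
      suc (suc (∣ N₁ ∣ + ∣ N₂ ∣))                   ≡⟨ cong suc (+-suc ∣ N₁ ∣ ∣ N₂ ∣) ⟨
      suc ∣ N₁ ∣ + suc ∣ N₂ ∣                       ≤⟨ +-mono-≤ violation₁ violation₂ ⟩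
      ∣ S₁ ∣ + ∣ S₂ ∣                               ≡⟨ ∣∪∣+∣∩∣ S₁ S₂ ⟨
      ∣ U ∣ + ∣ S₁ ∩ S₂ ∣                           ≡⟨ cong (∣ U ∣ +_) (∣S∣≡1+∣S∖⁅x⁆∣ (∩⁺ x∈S₁ x∈S₂)) ⟩
      ∣ U ∣ + suc ∣ I ∣                             ≡⟨ +-suc ∣ U ∣ ∣ I ∣ ⟩
      suc (∣ U ∣ + ∣ I ∣)                           ∎)
      where
      open ≤-Reasoning
      U⊆X : U ⊆ X
      U⊆X = [ S₁⊆X , S₂⊆X ]′ ∘ ∪⁻
      I⊆X : I ⊆ X
      I⊆X = S₁⊆X ∘ proj₁ ∘ ∩⁻ ∘ proj₁ ∘ ∖⁻

  hall-step : ∀ {X A e₁ e₂} → HallCondition X A → e₁ ≢ e₂ → left e₁ ≡ left e₂ →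
              HallCondition X (A ∖ ⁅ e₁ ⁆) ⊎ HallCondition X (A ∖ ⁅ e₂ ⁆)
  hall-step {X} {A} {e₁} {e₂} hall e₁≢e₂ le₁≡le₂ with hall? X (A ∖ ⁅ e₁ ⁆) | hall? X (A ∖ ⁅ e₂ ⁆)
  ... | inj₁ hall₁ | _          = inj₁ hall₁
  ... | inj₂ _     | inj₁ hall₂ = inj₂ hall₂
  ... | inj₂ (S₁ , S₁⊆X , violation₁) | inj₂ (S₂ , S₂⊆X , violation₂) =
    ⊥-elim (TwoViolators.impossible hall e₁≢e₂ le₁≡le₂ S₁⊆X violation₁ S₂⊆X violation₂)

  saturating-mono : ∀ {X A A′ M} → A′ ⊆ A → SaturatingMatching X A′ M → SaturatingMatching X A M
  saturating-mono A′⊆A (M⊆A′ , degˡ , degʳ) = A′⊆A ∘ M⊆A′ , degˡ , degʳ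

  hall-theorem : ∀ {X} A → HallCondition X A → ∃ (SaturatingMatching X A)
  hall-theorem A = go A (<-wellFounded ∣ A ∣)
    where
    go : ∀ {X} A → Acc _<_ ∣ A ∣ → HallCondition X A → ∃ (SaturatingMatching X A)
    go {X} A (acc smaller) hall
      with any? (λ e₁ → any? (λ e₂ → ¬? (e₁ ≟ e₂) ×-dec e₁ ∈? A ×-dec e₂ ∈? A ×-dec left e₁ ≟ left e₂ ×-dec left e₁ ∈? X))
    ... | no no-shared-left = _ , hall-base hall unique
      where
      unique : ∀ {e e′} → e ∈ A → e′ ∈ A → left e ∈ X → left e ≡ left e′ → e ≡ e′
      unique {e} {e′} e∈A e′∈A le∈X le≡le′ with e ≟ e′
      ... | yes e≡e′ = e≡e′
      ... | no  e≢e′ = contradiction (e , e′ , e≢e′ , e∈A , e′∈A , le≡le′ , le∈X) no-shared-left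
    ... | yes (e₁ , e₂ , e₁≢e₂ , e₁∈A , e₂∈A , le₁≡le₂ , _) with hall-step hall e₁≢e₂ le₁≡le₂
    ...   | inj₁ hall₁ = map₂ (saturating-mono (proj₁ ∘ ∖⁻)) (go (A ∖ ⁅ e₁ ⁆) (smaller (∣S∖⁅x⁆∣<∣S∣ e₁∈A)) hall₁)
    ...   | inj₂ hall₂ = map₂ (saturating-mono (proj₁ ∘ ∖⁻)) (go (A ∖ ⁅ e₂ ⁆) (smaller (∣S∖⁅x⁆∣<∣S∣ e₂∈A)) hall₂)

  Regular : ℕ → (Fin E → Bool) → Set
  Regular d A = RegularAt left d A × RegularAt right d A

  PerfectMatching : (Fin E → Bool) → (Fin E → Bool) → Set
  PerfectMatching A M = M ⊆ A × PerfectAt left A M × PerfectAt right A M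

  regular-hall : ∀ {d A} → Regular (suc d) A → HallCondition (support (deg left A)) A
  regular-hall {d} {A} (regularˡ , regularʳ) S S⊆X = *-cancelˡ-≤ (suc d) (begin
    suc d * ∣ S ∣                                 ≡⟨ *-distribˡ-sum (suc d) (𝟙 ∘ S) ⟩
    ∑[ x < a ] (suc d * 𝟙 (S x))                  ≡⟨ sum-cong-≗ full-degree ⟩
    ∑[ x < a ] (𝟙 (S x) * deg left A x)           ≡⟨ ∑-deg-restricted left A S ⟩
    ∣ A ∩ S ∘ left ∣                              ≡⟨ handshake right (A ∩ S ∘ left) ⟨
    ∑[ y < b ] deg right (A ∩ S ∘ left) y         ≤⟨ sum-mono-≤ bounded ⟩
    ∑[ y < b ] (suc d * 𝟙 (nbr A S y))            ≡⟨ *-distribˡ-sum (suc d) (𝟙 ∘ nbr A S) ⟨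
    suc d * ∣ nbr A S ∣                           ∎)
    where
    open ≤-Reasoning
    full-degree : ∀ x → suc d * 𝟙 (S x) ≡ 𝟙 (S x) * deg left A x
    full-degree x with S x in Sx
    ... | false = *-zeroʳ (suc d)
    ... | true  = begin-equality
      suc d * 1                          ≡⟨ cong (λ s → suc d * 𝟙 s) (∈⇒≡true (S⊆X (≡true⇒∈ Sx))) ⟨
      suc d * 𝟙 (support (deg left A) x) ≡⟨ regular-deg left regularˡ x ⟨
      deg left A x                       ≡⟨ *-identityˡ (deg left A x) ⟨
      1 * deg left A x                   ∎
    bounded : ∀ y → deg right (A ∩ S ∘ left) y ≤ suc d * 𝟙 (0 <ᵇ deg right (A ∩ S ∘ left) y)
    bounded y with deg right (A ∩ S ∘ left) y in deg≡
    ... | zero  = z≤n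
    ... | suc k = begin
      suc k                         ≡⟨ deg≡ ⟨
      deg right (A ∩ S ∘ left) y    ≤⟨ deg-mono right (proj₁ ∘ ∩⁻) y ⟩
      deg right A y                 ≤⟨ regular-≤ right regularʳ y ⟩
      suc d                         ≡⟨ *-identityʳ (suc d) ⟨
      suc d * 1                     ∎

  perfect-matching : ∀ {d A} → Regular (suc d) A → ∃ (PerfectMatching A)
  perfect-matching {d} {A} regular@(regularˡ , regularʳ) with hall-theorem A (regular-hall regular)
  ... | M , M⊆A , degˡ , degʳ≤1 = M , M⊆A , degˡ , sum-≡⇒≗ degʳ≤𝟙 ∑degʳ
    where
    open ≡-Reasoning
    X Y : _
    X = support (deg left A)
    Y = support (deg right A)
    degʳ≤𝟙 : ∀ y → deg right M y ≤ 𝟙 (0 <ᵇ deg right A y)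
    degʳ≤𝟙 y with deg right A y in deg≡
    ... | zero  = ≤-trans (deg-mono right M⊆A y) (≤-reflexive deg≡)
    ... | suc _ = degʳ≤1 y
    ∣X∣≡∣Y∣ : ∣ X ∣ ≡ ∣ Y ∣
    ∣X∣≡∣Y∣ = *-cancelˡ-≡ ∣ X ∣ ∣ Y ∣ (suc d) (begin
      suc d * ∣ X ∣             ≡⟨ ∑-regular left regularˡ ⟨
      ∑[ x < a ] deg left A x   ≡⟨ handshake left A ⟩
      ∣ A ∣                     ≡⟨ handshake right A ⟨
      ∑[ y < b ] deg right A y  ≡⟨ ∑-regular right regularʳ ⟩
      suc d * ∣ Y ∣             ∎)
    ∑degʳ : ∑[ y < b ] deg right M y ≡ ∣ Y ∣
    ∑degʳ = begin
      ∑[ y < b ] deg right M y  ≡⟨ handshake right M ⟩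
      ∣ M ∣                     ≡⟨ handshake left M ⟨
      ∑[ x < a ] deg left M x   ≡⟨ sum-cong-≗ degˡ ⟩
      ∣ X ∣                     ≡⟨ ∣X∣≡∣Y∣ ⟩
      ∣ Y ∣                     ∎

  decompose : ∀ {K} d A → Regular d A → (req : Fin K → ℕ) → sum req ≡ d → Fin K →
              ∃ λ c → SplitsAt left d A req c × SplitsAt right d A req c
  decompose zero    A _ req ∑req≡0 h₀ = (λ _ → h₀) , splits-zero left A req (λ _ → h₀) ∑req≡0 , splits-zero right A req (λ _ → h₀) ∑req≡0
  decompose (suc d) A regular@(regularˡ , regularʳ) req ∑req≡1+d h₀
    with perfect-matching regular | sum-positive req (subst (0 <_) (sym ∑req≡1+d) z<s)
  ... | M , M⊆A , degˡM , degʳM | h₁ , 0<req-h₁ with decrement req h₁ 0<req-h₁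
  ...   | req′ , req≡ , ∑req≡1+∑req′
    with decompose d (A ∖ M) (regular-∖ left regularˡ M⊆A degˡM , regular-∖ right regularʳ M⊆A degʳM)
                   req′ (suc-injective (trans (sym ∑req≡1+∑req′) ∑req≡1+d)) h₀
  ...     | c′ , splitsˡ , splitsʳ =
    (λ e → if M e then h₁ else c′ e) ,
    splits-extend left {c′ = c′} M⊆A degˡM req≡ splitsˡ , splits-extend right {c′ = c′} M⊆A degʳM req≡ splitsʳ

-- Coverings in terms of degrees

end₁ end₂ : ∀ {n} → Ends n → Fin n
end₁ (ordinary a _) = a
end₁ (loop a)       = a
end₁ (semi a)       = a
end₂ (ordinary _ b) = b
end₂ (loop a)       = a
end₂ (semi a)       = a

eqInd-refl : ∀ {n} (a : Fin n) → eqInd a a ≡ 1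
eqInd-refl a with a ≟ a
... | yes _   = refl
... | no  a≢a = contradiction refl a≢a

mult-ordinary : ∀ {n} (a b u : Fin n) → mult (ordinary a b) u ≡ 𝟙 (does (a ≟ u)) + 𝟙 (does (b ≟ u))
mult-ordinary a b u = cong₂ _+_ (eqInd≡𝟙 a u) (eqInd≡𝟙 b u)

mult-positive⁻ : ∀ {n} x {u : Fin n} → 0 < mult x u → end₁ x ≡ u ⊎ end₂ x ≡ u
mult-positive⁻ (ordinary a b) {u} 0<mult with a ≟ u | b ≟ u
... | yes a≡u | _       = inj₁ a≡u
... | no  _   | yes b≡u = inj₂ b≡u
... | no  _   | no  _   = contradiction 0<mult λ ()
mult-positive⁻ (loop a) {u} 0<mult with a ≟ u
... | yes a≡u = inj₁ a≡u
... | no  _   = contradiction 0<mult λ ()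
mult-positive⁻ (semi a) {u} 0<mult with a ≟ u
... | yes a≡u = inj₁ a≡u
... | no  _   = contradiction 0<mult λ ()

mult-end₁ : ∀ {n} (x : Ends n) → 0 < mult x (end₁ x)
mult-end₁ (ordinary a b) = subst (λ k → 0 < k + eqInd b a) (sym (eqInd-refl a)) z<s
mult-end₁ (loop a)       = subst (λ k → 0 < 2 * k) (sym (eqInd-refl a)) z<s
mult-end₁ (semi a)       = subst (0 <_) (sym (eqInd-refl a)) z<s

mult-end₂ : ∀ {n} (x : Ends n) → 0 < mult x (end₂ x)
mult-end₂ (ordinary a b) = subst (λ k → 0 < eqInd a b + k) (sym (eqInd-refl b)) (m≤n+m 1 (eqInd a b))
mult-end₂ (loop a)       = mult-end₁ (loop a)
mult-end₂ (semi a)       = mult-end₁ (semi a)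

end⇒mult-positive : ∀ {n} (x : Ends n) {w} → end₁ x ≡ w ⊎ end₂ x ≡ w → 0 < mult x w
end⇒mult-positive x (inj₁ refl) = mult-end₁ x
end⇒mult-positive x (inj₂ refl) = mult-end₂ x

mult≡required : ∀ {n} (x : Ends n) {w} → (∀ a b → x ≡ ordinary a b → a ≢ b) → 0 < mult x w → mult x w ≡ required x
mult≡required (ordinary a b) {w} proper 0<mult with a ≟ w | b ≟ w
... | yes a≡w | yes b≡w = contradiction (trans a≡w (sym b≡w)) (proper a b refl)
... | yes _   | no  _   = refl
... | no  _   | yes _   = refl
... | no  _   | no  _   = contradiction 0<mult λ ()
mult≡required (loop a) {w} _ 0<mult with a ≟ w
... | yes _ = refl
... | no  _ = contradiction 0<mult λ ()
mult≡required (semi a) {w} _ 0<mult with a ≟ w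
... | yes _ = refl
... | no  _ = contradiction 0<mult λ ()

module _ {G H : Graph} {fV : Fin (nV G) → Fin (nV H)} {fE : Fin (nE G) → Fin (nE H)} where

  EdgeOK-ends : ∀ x y {u} → EdgeOK G H fV fE x y → end₁ x ≡ u ⊎ end₂ x ≡ u → end₁ y ≡ fV u ⊎ end₂ y ≡ fV u
  EdgeOK-ends (loop a) _ refl end = inj₁ (cong fV ([ id , id ]′ end))
  EdgeOK-ends (semi a) _ refl end = inj₁ (cong fV ([ id , id ]′ end))
  EdgeOK-ends (ordinary a b) _ (inj₁ (_ , inj₁ refl)) end = Data.Sum.map (cong fV) (cong fV) end
  EdgeOK-ends (ordinary a b) _ (inj₁ (_ , inj₂ refl)) end = Data.Sum.swap (Data.Sum.map (cong fV) (cong fV) end)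
  EdgeOK-ends (ordinary a b) _ (inj₂ (fa≡fb , inj₁ refl)) end = inj₁ ([ cong fV , (λ b≡u → trans fa≡fb (cong fV b≡u)) ]′ end)
  EdgeOK-ends (ordinary a b) _ (inj₂ (fa≡fb , inj₂ refl)) end = inj₁ ([ cong fV , (λ b≡u → trans fa≡fb (cong fV b≡u)) ]′ end)

  EdgeOK-incident : ∀ x y {u} → EdgeOK G H fV fE x y → 0 < mult x u → 0 < mult y (fV u)
  EdgeOK-incident x y ok 0<mult = end⇒mult-positive y (EdgeOK-ends x y ok (mult-positive⁻ x 0<mult))

  preDeg-off : (∀ e → EdgeOK G H fV fE (edge G e) (edge H (fE e))) →
               ∀ u h → mult (edge H h) (fV u) ≡ 0 → preDeg G H fV fE u h ≡ 0
  preDeg-off ok u h mult≡0 = begin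
    preDeg G H fV fE u h                                  ≡⟨ sumFin≡sum (nE G) _ ⟩
    ∑[ e < nE G ] (eqInd (fE e) h * mult (edge G e) u)    ≡⟨ sum-cong-≗ no-edge ⟩
    ∑[ e < nE G ] 0                                       ≡⟨ sum-replicate-zero (nE G) ⟩
    0                                                     ∎
    where
    open ≡-Reasoning
    no-edge : ∀ e → eqInd (fE e) h * mult (edge G e) u ≡ 0
    no-edge e with fE e ≟ h
    ... | no  _    = refl
    ... | yes refl = trans (*-identityˡ _)
        (n≤0⇒n≡0 (≮⇒≥ λ 0<mult → n≮0 (subst (0 <_) mult≡0 (EdgeOK-incident (edge G e) (edge H (fE e)) (ok e) 0<mult))))

DegreeCovering : (G H : Graph) → (Fin (nV G) → Fin (nV H)) → (Fin (nE G) → Fin (nE H)) → Set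
DegreeCovering G H fV fE = (∀ e → EdgeOK G H fV fE (edge G e) (edge H (fE e))) ×
                           (∀ u h → preDeg G H fV fE u h ≡ mult (edge H h) (fV u))

covering⇔degreeCovering : ∀ {G H fV fE} → WellFormed H → IsCovering G H fV fE ⇔ DegreeCovering G H fV fE
covering⇔degreeCovering {G} {H} {fV} {fE} wf = mk⇔
  (λ (ok , required-deg) → ok , λ u h → preDeg≡mult ok required-deg u h)
  (λ (ok , mult-deg) → ok , λ h u 0<mult → trans (mult-deg u h) (mult≡required (edge H h) (wf h) 0<mult))
  where
  preDeg≡mult : (∀ e → EdgeOK G H fV fE (edge G e) (edge H (fE e))) →
                (∀ h u → 0 < mult (edge H h) (fV u) → preDeg G H fV fE u h ≡ required (edge H h)) →
                ∀ u h → preDeg G H fV fE u h ≡ mult (edge H h) (fV u)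
  preDeg≡mult ok required-deg u h with mult (edge H h) (fV u) in mult≡
  ... | zero  = preDeg-off ok u h mult≡
  ... | suc _ = trans (required-deg h u (subst (0 <_) (sym mult≡) z<s))
                      (sym (trans (sym mult≡) (mult≡required (edge H h) (wf h) (subst (0 <_) (sym mult≡) z<s))))

∑-preDeg : ∀ {G H fV fE} (w : Fin (nE H) → ℕ) u →
           ∑[ h < nE H ] (w h * preDeg G H fV fE u h) ≡ ∑[ e < nE G ] (mult (edge G e) u * w (fE e))
∑-preDeg {G} {H} {fV} {fE} w u = trans (sum-cong-≗ (λ h → cong (w h *_) (preDeg≡ h))) (∑-fibres fE (λ e → mult (edge G e) u) w)
  where
  preDeg≡ : ∀ h → preDeg G H fV fE u h ≡ ∑[ e < nE G ] (mult (edge G e) u * 𝟙 (does (fE e ≟ h)))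
  preDeg≡ h = trans (sumFin≡sum (nE G) _)
                    (sum-cong-≗ (λ e → trans (cong (_* mult (edge G e) u) (eqInd≡𝟙 (fE e) h)) (*-comm _ (mult (edge G e) u))))

relates : Bool → Bool → Bool → Bool
relates s c c′ = if does (c Bool.≟ c′) then s else not s

relates-sym : ∀ s c c′ → relates s c c′ ≡ relates s c′ c
relates-sym s true  true  = refl
relates-sym s true  false = refl
relates-sym s false true  = refl
relates-sym s false false = refl

colourWeight : ∀ {n} → (Fin n → Bool) → Bool → Ends n → ℕ
colourWeight χ s (ordinary a b) = 𝟙 (relates s (χ a) (χ b))
colourWeight χ s (loop _)       = 0
colourWeight χ s (semi _)       = 0

colourContribution : ∀ {n} → (Fin n → Bool) → Bool → Fin n → Ends n → ℕ
colourContribution χ s u (ordinary a b) = eqInd a u * 𝟙 (relates s (χ u) (χ b)) + eqInd b u * 𝟙 (relates s (χ u) (χ a))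
colourContribution χ s u (loop _)       = 0
colourContribution χ s u (semi _)       = 0

-- The summand of colNbr is local to its where-block; the type of colNbr-summand is inferred
-- from its use in colNbr≡∑contribution.
mutual
  colNbr≡∑contribution : ∀ G χ s u → colNbr G χ s u ≡ ∑[ e < nE G ] colourContribution χ s u (edge G e)
  colNbr≡∑contribution G χ s u = trans (sumFin≡sum (nE G) _) (sum-cong-≗ (colNbr-summand G χ s u))

  colNbr-summand : ∀ G χ s u (e : Fin (nE G)) → _ ≡ colourContribution χ s u (edge G e)
  colNbr-summand G χ s u e with edge G e
  ... | loop _ = refl
  ... | semi _ = refl
  ... | ordinary a b with χ u Bool.≟ χ a | χ u Bool.≟ χ b | s
  ...   | yes _ | yes _ | true  = refl
  ...   | yes _ | yes _ | false = refl
  ...   | yes _ | no  _ | true  = refl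
  ...   | yes _ | no  _ | false = refl
  ...   | no  _ | yes _ | true  = refl
  ...   | no  _ | yes _ | false = refl
  ...   | no  _ | no  _ | true  = refl
  ...   | no  _ | no  _ | false = refl

colourContribution≡ : ∀ {n} (χ : Fin n → Bool) s u x → colourContribution χ s u x ≡ colourWeight χ s x * mult x u
colourContribution≡ χ s u (loop _) = refl
colourContribution≡ χ s u (semi _) = refl
colourContribution≡ χ s u (ordinary a b) with a ≟ u | b ≟ u
... | yes refl | yes refl = trans (cong₂ _+_ (*-identityˡ w) (*-identityˡ w))
                                  (sym (trans (*-distribˡ-+ w 1 1) (cong₂ _+_ (*-identityʳ w) (*-identityʳ w))))
  where
  w : ℕ
  w = 𝟙 (relates s (χ a) (χ a))
... | yes refl | no  _    = trans (+-identityʳ (1 * w)) (trans (*-identityˡ w) (sym (*-identityʳ w)))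
  where
  w : ℕ
  w = 𝟙 (relates s (χ a) (χ b))
... | no  _    | yes refl = trans (*-identityˡ _) (trans (cong 𝟙 (relates-sym s (χ b) (χ a))) (sym (*-identityʳ (𝟙 (relates s (χ a) (χ b))))))
... | no  _    | no  _    = sym (*-zeroʳ (𝟙 (relates s (χ a) (χ b))))

colNbr≡ : ∀ G χ s u → colNbr G χ s u ≡ ∑[ e < nE G ] (colourWeight χ s (edge G e) * mult (edge G e) u)
colNbr≡ G χ s u = trans (colNbr≡∑contribution G χ s u) (sum-cong-≗ (λ e → colourContribution≡ χ s u (edge G e)))

isOrdinary : ∀ {n} → Ends n → Bool
isOrdinary (ordinary _ _) = true
isOrdinary (loop _)       = false
isOrdinary (semi _)       = false

-- linkWeight s y is 1 iff the lifts of y join equally coloured vertices (s = true), resp.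
-- differently coloured ones (s = false).
linkWeight : ∀ {n} → Bool → Ends n → ℕ
linkWeight s y = 𝟙 (if isOrdinary y then not s else s)

linkWeight-partition : ∀ {n} (y : Ends n) k → linkWeight true y * k + linkWeight false y * k ≡ k
linkWeight-partition (ordinary _ _) k = +-identityʳ k
linkWeight-partition (loop _)       k = trans (+-identityʳ (k + 0)) (+-identityʳ k)
linkWeight-partition (semi _)       k = trans (+-identityʳ (k + 0)) (+-identityʳ k)

sum-lookup-++ : ∀ {A : Set} {m n} (xs : Vec A m) (ys : Vec A n) (g : A → ℕ) →
                ∑[ i < m + n ] g (lookup (xs ++ ys) i) ≡ ∑[ i < m ] g (lookup xs i) + ∑[ i < n ] g (lookup ys i)
sum-lookup-++ []       ys g = refl
sum-lookup-++ (x ∷ xs) ys g = trans (cong (g x +_) (sum-lookup-++ xs ys g)) (sym (+-assoc (g x) _ _))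

sum-lookup-replicate : ∀ {A : Set} m (x : A) (g : A → ℕ) → ∑[ i < m ] g (lookup (replicate m x) i) ≡ m * g x
sum-lookup-replicate zero    x g = refl
sum-lookup-replicate (suc m) x g = cong (g x +_) (sum-lookup-replicate m x g)

all-replicate : ∀ {A : Set} {P : A → Set} m {x} → P x → All P (replicate m x)
all-replicate zero    px = []
all-replicate (suc m) px = px ∷ all-replicate m px

module _ (k m ℓ p q : ℕ) where

  ∑-W : ∀ (g : Ends 2 → ℕ) → ∑[ h < nE (W k m ℓ p q) ] g (edge (W k m ℓ p q) h) ≡
        k * g (semi zero) + (m * g (loop zero) + (ℓ * g (ordinary zero (suc zero)) + (p * g (loop (suc zero)) + q * g (semi (suc zero)))))
  ∑-W g = begin
    _ ≡⟨ sum-lookup-++ (replicate k _) _ g ⟩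
    _ ≡⟨ cong₂ _+_ (sum-lookup-replicate k _ g) (sum-lookup-++ (replicate m _) _ g) ⟩
    _ ≡⟨ cong (k * g (semi zero) +_) (cong₂ _+_ (sum-lookup-replicate m _ g) (sum-lookup-++ (replicate ℓ _) _ g)) ⟩
    _ ≡⟨ cong (λ t → k * g (semi zero) + (m * g (loop zero) + t))
              (cong₂ _+_ (sum-lookup-replicate ℓ _ g) (sum-lookup-++ (replicate p _) _ g)) ⟩
    _ ≡⟨ cong (λ t → k * g (semi zero) + (m * g (loop zero) + (ℓ * g (ordinary zero (suc zero)) + t)))
              (cong₂ _+_ (sum-lookup-replicate p _ g) (sum-lookup-replicate q _ g)) ⟩
    _ ∎
    where open ≡-Reasoning

  W-edges : ∀ {P : Ends 2 → Set} → P (semi zero) → P (loop zero) → P (ordinary zero (suc zero)) →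
            P (loop (suc zero)) → P (semi (suc zero)) → ∀ h → P (edge (W k m ℓ p q) h)
  W-edges {P} P₁ P₂ P₃ P₄ P₅ = All.lookup⁺ {P = P}
    (All.++⁺ (all-replicate k P₁) (All.++⁺ (all-replicate m P₂) (All.++⁺ (all-replicate ℓ P₃)
      (All.++⁺ (all-replicate p P₄) (all-replicate q P₅)))))

  W-ordinary : ∀ h {a b} → edge (W k m ℓ p q) h ≡ ordinary a b → a ≡ zero × b ≡ suc zero
  W-ordinary = W-edges {λ y → ∀ {a b} → y ≡ ordinary a b → a ≡ zero × b ≡ suc zero}
                       (λ ()) (λ ()) (λ { refl → refl , refl }) (λ ()) (λ ())

  W-wellFormed : WellFormed (W k m ℓ p q)
  W-wellFormed h a b edge≡ with W-ordinary h edge≡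
  ... | refl , refl = λ ()

  W-cross-weight : ∀ h w → linkWeight false (edge (W k m ℓ p q) h) * mult (edge (W k m ℓ p q) h) w ≡
                           linkWeight false (edge (W k m ℓ p q) h)
  W-cross-weight = W-edges {λ y → ∀ w → linkWeight false y * mult y w ≡ linkWeight false y}
                           (λ _ → refl) (λ _ → refl) (λ { zero → refl ; (suc zero) → refl }) (λ _ → refl) (λ _ → refl)

  W-same-degree₀ : ∑[ h < nE (W k m ℓ p q) ] (linkWeight true (edge (W k m ℓ p q) h) * mult (edge (W k m ℓ p q) h) zero) ≡ k + 2 * m
  W-same-degree₀ = trans (∑-W (λ y → linkWeight true y * mult y zero)) (arithmetic k m ℓ p q)
    where
    arithmetic : ∀ k m ℓ p q → k * 1 + (m * 2 + (ℓ * 0 + (p * 0 + q * 0))) ≡ k + 2 * m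
    arithmetic = solve-∀

  W-same-degree₁ : ∑[ h < nE (W k m ℓ p q) ] (linkWeight true (edge (W k m ℓ p q) h) * mult (edge (W k m ℓ p q) h) (suc zero)) ≡ 2 * p + q
  W-same-degree₁ = trans (∑-W (λ y → linkWeight true y * mult y (suc zero))) (arithmetic k m ℓ p q)
    where
    arithmetic : ∀ k m ℓ p q → k * 0 + (m * 0 + (ℓ * 0 + (p * 2 + q * 1))) ≡ 2 * p + q
    arithmetic = solve-∀

  W-cross-degree : ∑[ h < nE (W k m ℓ p q) ] linkWeight false (edge (W k m ℓ p q) h) ≡ ℓ
  W-cross-degree = trans (∑-W (linkWeight false)) (arithmetic k m ℓ p q)
    where
    arithmetic : ∀ k m ℓ p q → k * 0 + (m * 0 + (ℓ * 1 + (p * 0 + q * 0))) ≡ ℓ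
    arithmetic = solve-∀

-- From a covering to a colouring

module _ {G H : Graph} {fV : Fin (nV G) → Fin (nV H)} {fE : Fin (nE G) → Fin (nE H)}
         (κ : Fin (nV H) → Bool) (κ-injective : ∀ {w w′} → κ w ≡ κ w′ → w ≡ w′) where

  colourWeight-EdgeOK : ∀ s x y → (∀ u → x ≢ loop u) → (∀ u → x ≢ semi u) → EdgeOK G H fV fE x y →
                        colourWeight (κ ∘ fV) s x ≡ linkWeight s y
  colourWeight-EdgeOK s (loop u) y not-loop _ _ = contradiction refl (not-loop u)
  colourWeight-EdgeOK s (semi u) y _ not-semi _ = contradiction refl (not-semi u)
  colourWeight-EdgeOK s (ordinary a b) _ _ _ (inj₁ (fa≢fb , inj₁ refl)) =
    cong (λ d → 𝟙 (if d then s else not s)) (dec-false (κ (fV a) Bool.≟ κ (fV b)) (fa≢fb ∘ κ-injective))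
  colourWeight-EdgeOK s (ordinary a b) _ _ _ (inj₁ (fa≢fb , inj₂ refl)) =
    cong (λ d → 𝟙 (if d then s else not s)) (dec-false (κ (fV a) Bool.≟ κ (fV b)) (fa≢fb ∘ κ-injective))
  colourWeight-EdgeOK s (ordinary a b) _ _ _ (inj₂ (fa≡fb , inj₁ refl)) =
    cong (λ d → 𝟙 (if d then s else not s)) (dec-true (κ (fV a) Bool.≟ κ (fV b)) (cong κ fa≡fb))
  colourWeight-EdgeOK s (ordinary a b) _ _ _ (inj₂ (fa≡fb , inj₂ refl)) =
    cong (λ d → 𝟙 (if d then s else not s)) (dec-true (κ (fV a) Bool.≟ κ (fV b)) (cong κ fa≡fb))

  colNbr-covering : (∀ e u → edge G e ≢ loop u) → NoSemiEdges G → DegreeCovering G H fV fE →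
                    ∀ s u → colNbr G (κ ∘ fV) s u ≡ ∑[ h < nE H ] (linkWeight s (edge H h) * mult (edge H h) (fV u))
  colNbr-covering no-loop no-semi (ok , preDeg≡) s u = begin
    colNbr G (κ ∘ fV) s u                                            ≡⟨ colNbr≡ G (κ ∘ fV) s u ⟩
    ∑[ e < nE G ] (colourWeight (κ ∘ fV) s (edge G e) * mult (edge G e) u)
      ≡⟨ sum-cong-≗ (λ e → trans (cong (_* mult (edge G e) u) (weight≡ e)) (*-comm _ (mult (edge G e) u))) ⟩
    ∑[ e < nE G ] (mult (edge G e) u * linkWeight s (edge H (fE e)))  ≡⟨ ∑-preDeg {G} {H} {fV} {fE} (linkWeight s ∘ edge H) u ⟨
    ∑[ h < nE H ] (linkWeight s (edge H h) * preDeg G H fV fE u h)     ≡⟨ sum-cong-≗ (λ h → cong (linkWeight s (edge H h) *_) (preDeg≡ u h)) ⟩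
    ∑[ h < nE H ] (linkWeight s (edge H h) * mult (edge H h) (fV u))   ∎
    where
    open ≡-Reasoning
    weight≡ : ∀ e → colourWeight (κ ∘ fV) s (edge G e) ≡ linkWeight s (edge H (fE e))
    weight≡ e = colourWeight-EdgeOK s (edge G e) (edge H (fE e)) (no-loop e) (no-semi e) (ok e)

isZero : Fin 2 → Bool
isZero zero       = true
isZero (suc zero) = false

isZero-injective : ∀ {w w′} → isZero w ≡ isZero w′ → w ≡ w′
isZero-injective {zero}     {zero}     _ = refl
isZero-injective {suc zero} {suc zero} _ = refl
isZero-injective {zero}     {suc zero} ()
isZero-injective {suc zero} {zero}     ()

covering⇒colouring : ∀ k m ℓ p q → k + 2 * m ≡ 2 * p + q → (G : Graph) → (∀ e u → edge G e ≢ loop u) → NoSemiEdges G →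
                      ∀ {fV fE} → DegreeCovering G (W k m ℓ p q) fV fE → IsColoring (k + 2 * m) ℓ G (isZero ∘ fV)
covering⇒colouring k m ℓ p q balanced G no-loop no-semi {fV} covering u = same , different
  where
  counts : ∀ s v → colNbr G (isZero ∘ fV) s v ≡
                   ∑[ h < nE (W k m ℓ p q) ] (linkWeight s (edge (W k m ℓ p q) h) * mult (edge (W k m ℓ p q) h) (fV v))
  counts = colNbr-covering isZero isZero-injective no-loop no-semi covering
  same : colNbr G (isZero ∘ fV) true u ≡ k + 2 * m
  same with fV u | counts true u
  ... | zero     | count = trans count (W-same-degree₀ k m ℓ p q)
  ... | suc zero | count = trans count (trans (W-same-degree₁ k m ℓ p q) (sym balanced))
  different : colNbr G (isZero ∘ fV) false u ≡ ℓ
  different = trans (counts false u) (trans (sum-cong-≗ (λ h → W-cross-weight k m ℓ p q h (fV u))) (W-cross-degree k m ℓ p q))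

-- From a colouring to a covering

EdgeOK-swap : ∀ {G H fV fE} a b y → EdgeOK G H fV fE (ordinary a b) y → EdgeOK G H fV fE (ordinary b a) y
EdgeOK-swap a b y (inj₁ (fa≢fb , y≡)) = inj₁ (fa≢fb ∘ sym , Data.Sum.swap y≡)
EdgeOK-swap a b y (inj₂ (fa≡fb , inj₁ refl)) = inj₂ (sym fa≡fb , inj₁ (cong loop fa≡fb))
EdgeOK-swap a b y (inj₂ (fa≡fb , inj₂ refl)) = inj₂ (sym fa≡fb , inj₂ (cong semi fa≡fb))

-- Each edge is oriented from its β-true end to its β-false end, which makes G a bipartite
-- multigraph whose two sides are both indexed by all vertices.
module Orientation (G : Graph) (no-loop : ∀ e u → edge G e ≢ loop u) (no-semi : NoSemiEdges G)
                   (β : Fin (nV G) → Bool) (proper : ∀ e u v → edge G e ≡ ordinary u v → β u ≢ β v) where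

  ordinary-ends : ∀ e → edge G e ≡ ordinary (end₁ (edge G e)) (end₂ (edge G e))
  ordinary-ends e with edge G e | no-loop e | no-semi e
  ... | ordinary a b | _       | _       = refl
  ... | loop a       | not-loop | _       = contradiction refl (not-loop a)
  ... | semi a       | _       | not-semi = contradiction refl (not-semi a)

  left right : Fin (nE G) → Fin (nV G)
  left  e = if β (end₁ (edge G e)) then end₁ (edge G e) else end₂ (edge G e)
  right e = if β (end₁ (edge G e)) then end₂ (edge G e) else end₁ (edge G e)

  oriented : ∀ e → edge G e ≡ ordinary (left e) (right e) ⊎ edge G e ≡ ordinary (right e) (left e)
  oriented e with β (end₁ (edge G e))
  ... | true  = inj₁ (ordinary-ends e)
  ... | false = inj₂ (ordinary-ends e)

  β-left : ∀ e → β (left e) ≡ true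
  β-left e with β (end₁ (edge G e)) in β₁ | proper e _ _ (ordinary-ends e)
  ... | true  | _      = β₁
  ... | false | β₁≢β₂ = ¬-not (β₁≢β₂ ∘ sym)

  β-right : ∀ e → β (right e) ≡ false
  β-right e with β (end₁ (edge G e)) in β₁ | proper e _ _ (ordinary-ends e)
  ... | true  | β₁≢β₂ = ¬-not (β₁≢β₂ ∘ sym)
  ... | false | _      = β₁

  mult-oriented : ∀ e u → mult (edge G e) u ≡ 𝟙 (does (left e ≟ u)) + 𝟙 (does (right e ≟ u))
  mult-oriented e u with oriented e
  ... | inj₁ edge≡ = trans (cong (λ x → mult x u) edge≡) (mult-ordinary (left e) (right e) u)
  ... | inj₂ edge≡ = trans (cong (λ x → mult x u) edge≡)
                           (trans (mult-ordinary (right e) (left e) u) (+-comm (𝟙 (does (right e ≟ u))) _))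

  colourWeight-oriented : ∀ χ s e → colourWeight χ s (edge G e) ≡ 𝟙 (relates s (χ (left e)) (χ (right e)))
  colourWeight-oriented χ s e with oriented e
  ... | inj₁ edge≡ = cong (colourWeight χ s) edge≡
  ... | inj₂ edge≡ = trans (cong (colourWeight χ s) edge≡) (cong 𝟙 (relates-sym s (χ (right e)) (χ (left e))))

  EdgeOK-oriented : ∀ {H fV fE} e → EdgeOK G H fV fE (ordinary (left e) (right e)) (edge H (fE e)) →
                    EdgeOK G H fV fE (edge G e) (edge H (fE e))
  EdgeOK-oriented {H} {fV} {fE} e ok with oriented e
  ... | inj₁ edge≡ = subst (λ x → EdgeOK G H fV fE x (edge H (fE e))) (sym edge≡) ok
  ... | inj₂ edge≡ = subst (λ x → EdgeOK G H fV fE x (edge H (fE e))) (sym edge≡)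
                           (EdgeOK-swap {G} {H} {fV} {fE} (left e) (right e) (edge H (fE e)) ok)

  degG : (Fin (nE G) → Bool) → Fin (nV G) → ℕ
  degG C u = ∑[ e < nE G ] (𝟙 (C e) * mult (edge G e) u)

  degG≡ : ∀ C u → degG C u ≡ deg left C u + deg right C u
  degG≡ C u = trans (sum-cong-≗ split) (∑-distrib-+ (λ e → 𝟙 (C e ∧ fibre left u e)) (λ e → 𝟙 (C e ∧ fibre right u e)))
    where
    split : ∀ e → 𝟙 (C e) * mult (edge G e) u ≡ 𝟙 (C e ∧ fibre left u e) + 𝟙 (C e ∧ fibre right u e)
    split e = begin
      𝟙 (C e) * mult (edge G e) u                                          ≡⟨ cong (𝟙 (C e) *_) (mult-oriented e u) ⟩
      𝟙 (C e) * (𝟙 (fibre left u e) + 𝟙 (fibre right u e))                 ≡⟨ *-distribˡ-+ (𝟙 (C e)) _ _ ⟩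
      𝟙 (C e) * 𝟙 (fibre left u e) + 𝟙 (C e) * 𝟙 (fibre right u e)         ≡⟨ cong₂ _+_ (𝟙-∧ (C e) _) (𝟙-∧ (C e) _) ⟨
      𝟙 (C e ∧ fibre left u e) + 𝟙 (C e ∧ fibre right u e)                 ∎
      where open ≡-Reasoning

  deg-right≡0 : ∀ C u → β u ≡ true → deg right C u ≡ 0
  deg-right≡0 C u βu = ∣∣-empty λ e∈ → let _ , e∈fibre = ∩⁻ e∈ in
    contradiction (trans (sym (β-right _)) (trans (cong β (fibre⁻ right e∈fibre)) βu)) λ ()

  deg-left≡0 : ∀ C u → β u ≡ false → deg left C u ≡ 0
  deg-left≡0 C u βu = ∣∣-empty λ e∈ → let _ , e∈fibre = ∩⁻ e∈ in
    contradiction (trans (sym (β-left _)) (trans (cong β (fibre⁻ left e∈fibre)) βu)) λ ()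


  open BipartiteMultigraph left right public

  degG≡degˡ : ∀ C {u} → β u ≡ true → degG C u ≡ deg left C u
  degG≡degˡ C {u} βu = trans (degG≡ C u) (trans (cong (deg left C u +_) (deg-right≡0 C u βu)) (+-identityʳ _))

  degG≡degʳ : ∀ C {u} → β u ≡ false → degG C u ≡ deg right C u
  degG≡degʳ C {u} βu = trans (degG≡ C u) (cong (_+ deg right C u) (deg-left≡0 C u βu))

  regular-by-degG : ∀ {D C} → (∀ u → degG C u ≡ 0 ⊎ degG C u ≡ D) → Regular D C
  regular-by-degG {D} {C} regular = regularˡ , regularʳ
    where
    regularˡ : RegularAt left D C
    regularˡ u with β u in βu
    ... | true  = subst (λ k → k ≡ 0 ⊎ k ≡ D) (degG≡degˡ C βu) (regular u)
    ... | false = inj₁ (deg-left≡0 C u βu)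
    regularʳ : RegularAt right D C
    regularʳ u with β u in βu
    ... | true  = inj₁ (deg-right≡0 C u βu)
    ... | false = subst (λ k → k ≡ 0 ⊎ k ≡ D) (degG≡degʳ C βu) (regular u)

  splits-degG : ∀ {K D C} {req : Fin K → ℕ} {c} → SplitsAt left D C req c → SplitsAt right D C req c →
                ∀ h u → degG C u ≡ D → degG (C ∩ fibre c h) u ≡ req h
  splits-degG {C = C} {c = c} splitsˡ splitsʳ h u degG≡D with β u in βu
  ... | true  = trans (degG≡degˡ (C ∩ fibre c h) βu) (splitsˡ h u (trans (sym (degG≡degˡ C βu)) degG≡D))
  ... | false = trans (degG≡degʳ (C ∩ fibre c h) βu) (splitsʳ h u (trans (sym (degG≡degʳ C βu)) degG≡D))

  oriented-ends : ∀ {e u} → 0 < mult (edge G e) u → left e ≡ u ⊎ right e ≡ u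
  oriented-ends {e} {u} 0<mult with oriented e
  ... | inj₁ edge≡ = mult-positive⁻ (ordinary (left e) (right e)) (subst (λ x → 0 < mult x u) edge≡ 0<mult)
  ... | inj₂ edge≡ = Data.Sum.swap (mult-positive⁻ (ordinary (right e) (left e)) (subst (λ x → 0 < mult x u) edge≡ 0<mult))

  degG-local : ∀ {C C′ u} → (∀ e → 0 < mult (edge G e) u → C e ≡ C′ e) → degG C u ≡ degG C′ u
  degG-local {C} {C′} {u} agree = sum-cong-≗ pointwise
    where
    pointwise : ∀ e → 𝟙 (C e) * mult (edge G e) u ≡ 𝟙 (C′ e) * mult (edge G e) u
    pointwise e with mult (edge G e) u in mult≡
    ... | zero  = trans (*-zeroʳ (𝟙 (C e))) (sym (*-zeroʳ (𝟙 (C′ e))))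
    ... | suc _ = cong (λ b → 𝟙 b * suc _) (agree e (subst (0 <_) (sym mult≡) z<s))

  degG-∅ : ∀ u → degG (λ _ → false) u ≡ 0
  degG-∅ u = sum-replicate-zero (nE G)

  degG-+ : ∀ {C A B} → (∀ e → 𝟙 (C e) ≡ 𝟙 (A e) + 𝟙 (B e)) → ∀ u → degG C u ≡ degG A u + degG B u
  degG-+ {C} {A} {B} split u = trans (sum-cong-≗ pointwise) (∑-distrib-+ (λ e → 𝟙 (A e) * mult (edge G e) u) _)
    where
    pointwise : ∀ e → 𝟙 (C e) * mult (edge G e) u ≡ 𝟙 (A e) * mult (edge G e) u + 𝟙 (B e) * mult (edge G e) u
    pointwise e = trans (cong (_* mult (edge G e) u) (split e)) (*-distribʳ-+ (mult (edge G e) u) (𝟙 (A e)) (𝟙 (B e)))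

vertex : Bool → Fin 2
vertex true  = zero
vertex false = suc zero

does-≟⇒≡ : ∀ {c c′ : Bool} → does (c Bool.≟ c′) ≡ true → c ≡ c′
does-≟⇒≡ {true}  {true}  _ = refl
does-≟⇒≡ {false} {false} _ = refl

does-≟⇒≢ : ∀ {c c′ : Bool} → does (c Bool.≟ c′) ≡ false → c ≢ c′
does-≟⇒≢ {true}  {false} _ ()
does-≟⇒≢ {false} {true}  _ ()

relates-true : ∀ c c′ → relates true c c′ ≡ does (c Bool.≟ c′)
relates-true true  true  = refl
relates-true true  false = refl
relates-true false true  = refl
relates-true false false = refl

relates-false : ∀ c c′ → relates false c c′ ≡ not (does (c Bool.≟ c′))
relates-false true  true  = refl
relates-false true  false = refl
relates-false false true  = refl
relates-false false false = refl

selfDemand-positive : ∀ {n} (y : Ends n) {w} → 0 < linkWeight true y * mult y w → y ≡ loop w ⊎ y ≡ semi w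
selfDemand-positive (loop a) 0<demand with mult-positive⁻ (loop a) (subst (0 <_) (+-identityʳ _) 0<demand)
... | inj₁ refl = inj₁ refl
... | inj₂ refl = inj₁ refl
selfDemand-positive (semi a) 0<demand with mult-positive⁻ (semi a) (subst (0 <_) (+-identityʳ _) 0<demand)
... | inj₁ refl = inj₂ refl
... | inj₂ refl = inj₂ refl

crossDemand-positive : ∀ {n} (y : Ends n) → 0 < linkWeight false y → y ≡ ordinary (end₁ y) (end₂ y)
crossDemand-positive (ordinary a b) _ = refl

module FromColouring (k m ℓ p q : ℕ) (1≤ℓ : 1 ≤ ℓ) (balanced : k + 2 * m ≡ 2 * p + q)
                     (G : Graph) (no-loop : ∀ e u → edge G e ≢ loop u) (no-semi : NoSemiEdges G)
                     (β : Fin (nV G) → Bool) (proper : ∀ e u v → edge G e ≡ ordinary u v → β u ≢ β v)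
                     (χ : Fin (nV G) → Bool) (colouring : IsColoring (k + 2 * m) ℓ G χ) where

  open Orientation G no-loop no-semi β proper

  H : Graph
  H = W k m ℓ p q

  D : ℕ
  D = k + 2 * m

  monochromatic cross : Fin (nE G) → Bool
  monochromatic  e = does (χ (left e) Bool.≟ χ (right e))
  cross e = not (monochromatic e)

  same : Bool → Fin (nE G) → Bool
  same c e = monochromatic e ∧ does (χ (left e) Bool.≟ c)

  colNbr≡degG : ∀ s u → colNbr G χ s u ≡ degG (λ e → relates s (χ (left e)) (χ (right e))) u
  colNbr≡degG s u = trans (colNbr≡ G χ s u) (sum-cong-≗ (λ e → cong (_* mult (edge G e) u) (colourWeight-oriented χ s e)))

  degG-monochromatic : ∀ u → degG monochromatic u ≡ D
  degG-monochromatic u = trans (sym (trans (colNbr≡degG true u) (sum-cong-≗ (λ e → cong (λ b → 𝟙 b * mult (edge G e) u)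
                  (relates-true (χ (left e)) (χ (right e))))))) (proj₁ (colouring u))

  degG-cross : ∀ u → degG cross u ≡ ℓ
  degG-cross u = trans (sym (trans (colNbr≡degG false u) (sum-cong-≗ (λ e → cong (λ b → 𝟙 b * mult (edge G e) u)
                   (relates-false (χ (left e)) (χ (right e))))))) (proj₂ (colouring u))

  monochromatic-at : ∀ {e u} → monochromatic e ≡ true → 0 < mult (edge G e) u → χ (left e) ≡ χ u
  monochromatic-at {e} monochromatic≡ 0<mult with oriented-ends 0<mult
  ... | inj₁ refl = refl
  ... | inj₂ refl = does-≟⇒≡ monochromatic≡

  same-local : ∀ {e u} c → 0 < mult (edge G e) u → same c e ≡ monochromatic e ∧ does (χ u Bool.≟ c)
  same-local {e} c 0<mult with monochromatic e in monochromatic≡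
  ... | false = refl
  ... | true  = cong (λ c′ → does (c′ Bool.≟ c)) (monochromatic-at monochromatic≡ 0<mult)

  degG-same-own : ∀ u → degG (same (χ u)) u ≡ D
  degG-same-own u = trans (degG-local agree) (degG-monochromatic u)
    where
    agree : ∀ e → 0 < mult (edge G e) u → same (χ u) e ≡ monochromatic e
    agree e 0<mult = trans (same-local (χ u) 0<mult)
      (trans (cong (monochromatic e ∧_) (dec-true (χ u Bool.≟ χ u) refl)) (∧-identityʳ (monochromatic e)))

  degG-same-other : ∀ {c u} → χ u ≢ c → degG (same c) u ≡ 0
  degG-same-other {c} {u} χu≢c = trans (degG-local agree) (degG-∅ u)
    where
    agree : ∀ e → 0 < mult (edge G e) u → same c e ≡ false
    agree e 0<mult = trans (same-local c 0<mult)
      (trans (cong (monochromatic e ∧_) (dec-false (χ u Bool.≟ c) χu≢c)) (∧-zeroʳ (monochromatic e)))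

  degG-same : ∀ c u → degG (same c) u ≡ 0 ⊎ degG (same c) u ≡ D
  degG-same c u with χ u Bool.≟ c
  ... | yes refl = inj₂ (degG-same-own u)
  ... | no  χu≢c = inj₁ (degG-same-other χu≢c)

  selfDemand : Bool → Fin (nE H) → ℕ
  selfDemand c h = linkWeight true (edge H h) * mult (edge H h) (vertex c)

  crossDemand : Fin (nE H) → ℕ
  crossDemand h = linkWeight false (edge H h)

  ∑selfDemand : ∀ c → sum (selfDemand c) ≡ D
  ∑selfDemand true  = W-same-degree₀ k m ℓ p q
  ∑selfDemand false = trans (W-same-degree₁ k m ℓ p q) (sym balanced)

  -- The default colour required by decompose; W has an edge because ℓ ≥ 1.
  some-edge : Fin (nE H)
  some-edge = fromℕ< (≤-trans 1≤ℓ (≤-trans (m≤m+n ℓ (p + q)) (≤-trans (m≤n+m _ m) (m≤n+m _ k))))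

  sameRegular : ∀ c → Regular D (same c)
  sameRegular c = regular-by-degG (degG-same c)

  crossRegular : Regular ℓ cross
  crossRegular = regular-by-degG (λ u → inj₂ (degG-cross u))

  sameSplitting : ∀ c → ∃ λ col → SplitsAt left D (same c) (selfDemand c) col × SplitsAt right D (same c) (selfDemand c) col
  sameSplitting c = decompose D (same c) (sameRegular c) (selfDemand c) (∑selfDemand c) some-edge

  crossSplitting : ∃ λ col → SplitsAt left ℓ cross crossDemand col × SplitsAt right ℓ cross crossDemand col
  crossSplitting = decompose ℓ cross crossRegular crossDemand (W-cross-degree k m ℓ p q) some-edge

  splitColour : Bool → Fin (nE G) → Fin (nE H)
  splitColour c = proj₁ (sameSplitting c)

  splitColour-left : ∀ c → SplitsAt left D (same c) (selfDemand c) (splitColour c)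
  splitColour-left c = proj₁ (proj₂ (sameSplitting c))

  splitColour-right : ∀ c → SplitsAt right D (same c) (selfDemand c) (splitColour c)
  splitColour-right c = proj₂ (proj₂ (sameSplitting c))

  crossColour : Fin (nE G) → Fin (nE H)
  crossColour = proj₁ crossSplitting

  crossColour-left : SplitsAt left ℓ cross crossDemand crossColour
  crossColour-left = proj₁ (proj₂ crossSplitting)

  crossColour-right : SplitsAt right ℓ cross crossDemand crossColour
  crossColour-right = proj₂ (proj₂ crossSplitting)

  sameColour : Fin (nE G) → Fin (nE H)
  sameColour e = splitColour (χ (left e)) e

  fV : Fin (nV G) → Fin (nV H)
  fV = vertex ∘ χ

  fE : Fin (nE G) → Fin (nE H)
  fE e = if monochromatic e then sameColour e else crossColour e

  W-cross-edge : ∀ h → 0 < linkWeight false (edge H h) → edge H h ≡ ordinary zero (suc zero)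
  W-cross-edge h 0<weight = let edge≡ = crossDemand-positive (edge H h) 0<weight ; a≡0 , b≡1 = W-ordinary k m ℓ p q h edge≡
                            in trans edge≡ (cong₂ ordinary a≡0 b≡1)

  EdgeOK-cross : ∀ {a b} y → χ a ≢ χ b → y ≡ ordinary zero (suc zero) → EdgeOK G H fV fE (ordinary a b) y
  EdgeOK-cross {a} {b} y χa≢χb y≡ with χ a | χ b
  ... | true  | false = inj₁ ((λ ()) , inj₁ y≡)
  ... | false | true  = inj₁ ((λ ()) , inj₂ y≡)
  ... | true  | true  = contradiction refl χa≢χb
  ... | false | false = contradiction refl χa≢χb

  edgeOK : ∀ e → EdgeOK G H fV fE (edge G e) (edge H (fE e))
  edgeOK e = EdgeOK-oriented {H} {fV} {fE} e oriented-OK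
    where
    oriented-OK : EdgeOK G H fV fE (ordinary (left e) (right e)) (edge H (fE e))
    oriented-OK with monochromatic e in mono≡
    ... | true  = inj₂ (cong vertex (does-≟⇒≡ mono≡) , selfDemand-positive (edge H (sameColour e)) used)
      where
      e∈same : e ∈ same (χ (left e))
      e∈same = ≡true⇒∈ (cong₂ _∧_ mono≡ (dec-true (χ (left e) Bool.≟ χ (left e)) refl))
      used : 0 < selfDemand (χ (left e)) (sameColour e)
      used = splits-positive left {c = splitColour (χ (left e))} (proj₁ (sameRegular (χ (left e)))) (splitColour-left (χ (left e))) e∈same
    ... | false = EdgeOK-cross (edge H (crossColour e)) (does-≟⇒≢ mono≡) (W-cross-edge _ used)
      where
      used : 0 < crossDemand (crossColour e)
      used = splits-positive left {c = crossColour} (proj₁ crossRegular) crossColour-left (≡true⇒∈ (cong not mono≡))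

  preDeg≡degG : ∀ u h → preDeg G H fV fE u h ≡ degG (fibre fE h) u
  preDeg≡degG u h = trans (sumFin≡sum (nE G) _) (sum-cong-≗ (λ e → cong (_* mult (edge G e) u) (eqInd≡𝟙 (fE e) h)))

  fibre-split : ∀ h e → 𝟙 (fibre fE h e) ≡
                𝟙 ((monochromatic ∩ fibre sameColour h) e) + 𝟙 ((cross ∩ fibre (crossColour) h) e)
  fibre-split h e with monochromatic e
  ... | true  = sym (+-identityʳ _)
  ... | false = refl

  sameColour-at : ∀ u h → degG (monochromatic ∩ fibre sameColour h) u ≡
                          degG (same (χ u) ∩ fibre (splitColour (χ u)) h) u
  sameColour-at u h = degG-local agree
    where
    agree : ∀ e → 0 < mult (edge G e) u → monochromatic e ∧ does (sameColour e ≟ h) ≡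
                  (monochromatic e ∧ does (χ (left e) Bool.≟ χ u)) ∧ does (splitColour (χ u) e ≟ h)
    agree e 0<mult with monochromatic e in mono≡
    ... | false = refl
    ... | true  = let χl≡χu = monochromatic-at mono≡ 0<mult in
      trans (cong (λ c → does (splitColour c e ≟ h)) χl≡χu)
            (cong (_∧ does (splitColour (χ u) e ≟ h)) (sym (dec-true (χ (left e) Bool.≟ χ u) χl≡χu)))

  preDeg≡mult : ∀ u h → preDeg G H fV fE u h ≡ mult (edge H h) (fV u)
  preDeg≡mult u h = begin
    preDeg G H fV fE u h                                        ≡⟨ preDeg≡degG u h ⟩
    degG (fibre fE h) u                                         ≡⟨ degG-+ {A = monochromatic ∩ fibre sameColour h} {B = cross ∩ fibre crossColour h} (fibre-split h) u ⟩
    degG (monochromatic ∩ fibre sameColour h) u + degG (cross ∩ fibre (crossColour) h) u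
      ≡⟨ cong₂ _+_ (trans (sameColour-at u h) (splits-degG {c = splitColour (χ u)} (splitColour-left (χ u)) (splitColour-right (χ u)) h u (degG-same-own u)))
                   (splits-degG {c = crossColour} crossColour-left crossColour-right h u (degG-cross u)) ⟩
    selfDemand (χ u) h + crossDemand h                          ≡⟨ cong (selfDemand (χ u) h +_) (W-cross-weight k m ℓ p q h (fV u)) ⟨
    linkWeight true (edge H h) * mult (edge H h) (fV u) + linkWeight false (edge H h) * mult (edge H h) (fV u)
                                                                ≡⟨ linkWeight-partition (edge H h) (mult (edge H h) (fV u)) ⟩
    mult (edge H h) (fV u)                                      ∎
    where open ≡-Reasoning

  covering : DegreeCovering G H fV fE
  covering = edgeOK , preDeg≡mult

mainTheorem8 : (k m ℓ p q : ℕ) → 1 ≤ ℓ → k + 2 * m ≡ 2 * p + q →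
    (G : Graph) → WellFormed G → NoSemiEdges G → Bipartite G →
    Covers G (W k m ℓ p q) ⇔ HasColoring (k + 2 * m) ℓ G
mainTheorem8 k m ℓ p q 1≤ℓ balanced G _ no-semi (no-loop , β , proper) = mk⇔ to from
  where
  degree-form : ∀ {fV fE} → IsCovering G (W k m ℓ p q) fV fE ⇔ DegreeCovering G (W k m ℓ p q) fV fE
  degree-form = covering⇔degreeCovering (W-wellFormed k m ℓ p q)
  to : Covers G (W k m ℓ p q) → HasColoring (k + 2 * m) ℓ G
  to (fV , fE , covering) =
    isZero ∘ fV , covering⇒colouring k m ℓ p q balanced G no-loop no-semi (Equivalence.to degree-form covering)
  from : HasColoring (k + 2 * m) ℓ G → Covers G (W k m ℓ p q)
  from (χ , colouring) = fV , fE , Equivalence.from degree-form covering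
    where open FromColouring k m ℓ p q 1≤ℓ balanced G no-loop no-semi β proper χ colouring
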